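{- Let $r\geq 1$ and consider the Lie algebra of type $A_r$. Let $\ell$ and $m_1,\dots,m_r$ be nonnegative integers, $\lambda=\ell\varpi_1$ and $\mu=\sum_{i=1}^r m_i\varpi_i$. \begin{enumerate} \item If $\ell-\sum_{i=1}^r i\,m_i\equiv 0 \pmod{r+1}$, then $s_1\notin\mathcal{A}(\lambda,\mu)$. \item If $\ell-\sum_{i=1}^r i\,m_i=0$ and $m_j=0$ for all $3\leq j\leq r$, then $\mathcal{A}(\lambda,\mu)=\{1\}$. \item If $\ell-\sum_{i=1}^r i\,m_i=0$, $m_j=0$ for all $4\leq j\leq r$, and $m_3\neq 0$, then $\mathcal{A}(\lambda,\mu)=\{1,s_2\}$. \item If $\ell-\sum_{i=1}^r i\,m_i=0$, $m_j=0$ for all $5\leq j\leq r$, and $m_4\neq 0$, then $\mathcal{A}(\lambda,\mu)=\{1,s_2,s_3,s_2s_3\}$ if $m_4=1$, and $\mathcal{A}(\lambda,\mu)=\{1,s_2,s_3,s_2s_3,s_3s_2,s_2s_3s_2\}$ if $m_4\geq 2$. \end{enumerate}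
   Context: Type $A_r$: simple roots $\alpha_1,\dots,\alpha_r$; positive roots $\Phi^+=\{\alpha_i+\alpha_{i+1}+\cdots+\alpha_j: 1\le i\le j\le r\}$. Fundamental weights $\varpi_i=\frac{r+1-i}{r+1}(\alpha_1+2\alpha_2+\cdots+(i-1)\alpha_{i-1})+\frac{i}{r+1}((r-i+1)\alpha_i+(r-i)\alpha_{i+1}+\cdots+\alpha_r)$, and $\rho=\varpi_1+\cdots+\varpi_r$ (half the sum of positive roots). The Weyl group $W$ is generated by the simple reflections $s_1,\dots,s_r$, with $s_i(\alpha_i)=-\alpha_i$, $s_i(\alpha_j)=\alpha_i+\alpha_j$ if $|i-j|=1$, $s_i(\alpha_j)=\alpha_j$ if $|i-j|>1$, and $s_i(\varpi_j)=\varpi_j-\delta_{ij}\alpha_i$; $1$ denotes the identity. Kostant's partition function $\wp(\xi)$ is the number of ways to write $\xi$ as a nonnegative integral linear combination of positive roots. The Weyl alternation set is $\mathcal{A}(\lambda,\mu)=\{\sigma\in W:\wp(\sigma(\lambda+\rho)-(\mu+\rho))>0\}$. -}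

module Defs where

open import Data.Nat using (ℕ; zero; suc; _∸_; _≤ᵇ_; _≡ᵇ_; _<_; _≤_)
  renaming (_*_ to _*ℕ_; _+_ to _+ℕ_)
open import Data.Integer using (ℤ; +_; _+_; _-_; _*_; 0ℤ)
open import Data.Bool using (if_then_else_; _∧_)
open import Data.Fin using (Fin; toℕ) renaming (zero to fzero; suc to fsuc)
open import Data.List using (List; []; _∷_)
open import Data.Product using (Σ; _×_)
open import Relation.Binary.PropositionalEquality using (_≡_)

-- A weight is stored by its coordinates in the basis of simple
-- roots α_1,…,α_r, MULTIPLIED BY (r+1) so that all fundamental weights
-- (hence all weights involved) have integer coordinates.
-- Coordinate k : Fin r corresponds to α_{toℕ k + 1}.

Weight : ℕ → Set
Weight r = Fin r → ℤ

_⊕_ : ∀ {r} → Weight r → Weight r → Weight r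
(x ⊕ y) k = x k + y k

_⊖_ : ∀ {r} → Weight r → Weight r → Weight r
(x ⊖ y) k = x k - y k

finSum : ∀ {n} → (Fin n → ℤ) → ℤ
finSum {zero}  f = 0ℤ
finSum {suc n} f = f fzero + finSum (λ k → f (fsuc k))

-- 1-indexed coordinate, 0 outside the range 1..r
coordN : ∀ {n} → (Fin n → ℤ) → ℕ → ℤ
coordN {zero}  x j = 0ℤ
coordN {suc n} x zero = 0ℤ
coordN {suc n} x (suc zero) = x fzero
coordN {suc n} x (suc (suc j)) = coordN (λ k → x (fsuc k)) (suc j)

-- (r+1)·ϖ_i  (i is 1-indexed), from
-- ϖ_i = (r+1-i)/(r+1) (α_1+2α_2+…+(i-1)α_{i-1})
--       + i/(r+1) ((r-i+1)α_i+(r-i)α_{i+1}+…+α_r)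
fundW : (r : ℕ) → ℕ → Weight r
fundW r i k with suc (toℕ k)
... | k' = if k' ≤ᵇ i then + ((suc r ∸ i) *ℕ k') else + (i *ℕ (suc r ∸ k'))

rhoW : (r : ℕ) → Weight r
rhoW r k = finSum (λ (i : Fin r) → fundW r (suc (toℕ i)) k)

lambdaW : (r : ℕ) → ℕ → Weight r
lambdaW r ℓ k = + ℓ * fundW r 1 k

-- (r+1)·μ,  μ = Σ_i m_i ϖ_i   (m i is m_{toℕ i + 1})
muW : (r : ℕ) → (Fin r → ℕ) → Weight r
muW r m k = finSum (λ (i : Fin r) → + (m i) * fundW r (suc (toℕ i)) k)

-- simple reflection s_i (i is 1-indexed), acting linearly:
-- s_i(x) = x - (2x_i - x_{i-1} - x_{i+1}) α_i   (x_0 = x_{r+1} = 0),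
-- which is determined by s_i(α_i) = -α_i, s_i(α_j) = α_i+α_j (|i-j|=1),
-- s_i(α_j) = α_j (|i-j|>1).  (Identity if i ∉ {1..r}; only used in range.)
sN : ∀ {r} → ℕ → Weight r → Weight r
sN i x k = if suc (toℕ k) ≡ᵇ i
           then (coordN x (i ∸ 1) + coordN x (suc i)) - x k
           else x k

-- Weyl group elements as words in the generators s_1..s_r;
-- act (i₁ ∷ i₂ ∷ … ∷ iₖ ∷ []) = s_{i₁} ∘ s_{i₂} ∘ … ∘ s_{iₖ}
act : ∀ {r} → List (Fin r) → Weight r → Weight r
act []      x = x
act (i ∷ w) x = sN (suc (toℕ i)) (act w x)

-- equality of Weyl group elements = equality as linear maps
_≈W_ : ∀ {r} → (Weight r → Weight r) → (Weight r → Weight r) → Set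
f ≈W g = ∀ x k → f x k ≡ g x k

-- positive root α_i + … + α_j (unscaled coordinates), i ≤ j
posRoot : ∀ {r} → Fin r → Fin r → Weight r
posRoot i j k = if (toℕ i ≤ᵇ toℕ k) ∧ (toℕ k ≤ᵇ toℕ j) then + 1 else 0ℤ

-- ℘(ξ) > 0 for a weight ξ given in (r+1)-scaled coordinates ξs:
-- there is a nonnegative integral combination Σ_{i≤j} f i j (α_i+…+α_j) = ξ.
KostantPos : (r : ℕ) → Weight r → Set
KostantPos r ξs =
  Σ (Fin r → Fin r → ℕ) λ f →
    (∀ i j → toℕ j < toℕ i → f i j ≡ 0) ×
    (∀ k → ξs k ≡ + (suc r) * finSum (λ i → finSum (λ j → + (f i j) * posRoot i j k)))

-- σ ∈ 𝒜(λ,μ)  with λ = ℓϖ_1, μ = Σ m_i ϖ_i :  ℘(σ(λ+ρ) - (μ+ρ)) > 0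
InAlt : (r : ℕ) → ℕ → (Fin r → ℕ) → (Weight r → Weight r) → Set
InAlt r ℓ m σ = KostantPos r (σ (lambdaW r ℓ ⊕ rhoW r) ⊖ (muW r m ⊕ rhoW r))

-- m_j (1-indexed), 0 for j ∉ {1..r}
mAt : ∀ {r} → (Fin r → ℕ) → ℕ → ℕ
mAt {zero}  m j = 0
mAt {suc r} m zero = 0
mAt {suc r} m (suc zero) = m fzero
mAt {suc r} m (suc (suc j)) = mAt (λ k → m (fsuc k)) (suc j)

finSumℕ : ∀ {n} → (Fin n → ℕ) → ℕ
finSumℕ {zero}  f = 0
finSumℕ {suc n} f = f fzero +ℕ finSumℕ (λ k → f (fsuc k))

wsum : ∀ {r} → (Fin r → ℕ) → ℕ
wsum m = finSumℕ (λ k → suc (toℕ k) *ℕ m k)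

-- Measure weights in ε-coordinates: x = Σ x_i α_i has ε_{j+1}-coefficient x_{j+1} − x_j, since
-- α_i = ε_i − ε_{i+1}. Simple reflections then just permute ε-coordinates, and λ + ρ, μ + ρ have
-- explicit ε-coordinates. Every simple root is a positive root and every positive root is a sum of
-- simple roots, so ℘(ξ) > 0 iff the α-coordinates of ξ (partial sums of its ε-coordinates) are
-- nonnegative integers. For ξ = σ(λ+ρ) − (μ+ρ) with ℓ = Σ i m_i this is a dominance condition
-- which, read from the right, forces σ to fix ε_1 and every ε_j beyond the support of μ; what is
-- left is a permutation of ε_2, ε_3, ε_4, constrained by a single inequality involving m_4.
-- For σ = s₁ the first and the last α-coordinate of ξ already have a negative sum.

module Submission where

open import Defs
open import Data.Bool using (true; false; if_then_else_; _∧_)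
open import Data.Empty using (⊥-elim)
open import Data.Fin using (Fin; toℕ; fromℕ; fromℕ<) renaming (zero to fzero; suc to fsuc)
import Data.Fin.Properties as Finₚ
open import Data.Integer using (ℤ; +_; 0ℤ; _+_; _-_; _*_; ∣_∣; +≤+) renaming (_≤_ to _≤ℤ_)
open import Data.Integer.Divisibility using (_∣_)
import Data.Integer.Properties as ℤₚ
open import Data.Integer.Tactic.RingSolver using (solve-∀)
open import Data.List using (List; []; _∷_)
open import Data.Nat using (ℕ; zero; suc; _∸_; _≤_; _<_; _≥_; _≡ᵇ_; _≤ᵇ_; _≟_; _≤?_; _<?_; z≤n; s≤s)
  renaming (_+_ to _+ℕ_; _*_ to _*ℕ_)
import Data.Nat.Properties as ℕₚ
open import Data.Product using (Σ; _×_; _,_; proj₁; proj₂)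
open import Data.Sum using (_⊎_; inj₁; inj₂)
open import Function using (id; _∘_; _⇔_; mk⇔; Equivalence)
open import Relation.Binary.Definitions using (tri<; tri≈; tri>)
open import Relation.Binary.PropositionalEquality
open import Relation.Nullary using (¬_; yes; no)
open import Relation.Nullary.Decidable using (dec-true; dec-false)

coordN-zero : ∀ {r} (x : Weight r) → coordN x 0 ≡ 0ℤ
coordN-zero {zero}  x = refl
coordN-zero {suc r} x = refl

coordN-toℕ : ∀ {r} (x : Weight r) k → x k ≡ coordN x (suc (toℕ k))
coordN-toℕ {suc r} x fzero    = refl
coordN-toℕ {suc r} x (fsuc k) = coordN-toℕ (x ∘ fsuc) k

coordN-beyond : ∀ {r} (x : Weight r) k → r < k → coordN x k ≡ 0ℤ
coordN-beyond {zero}  x k             _         = refl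
coordN-beyond {suc r} x (suc (suc k)) (s≤s r<k) = coordN-beyond (x ∘ fsuc) (suc k) r<k

coordN-suc-unique : ∀ {r} (x : Weight r) (g : ℕ → ℤ) →
  (∀ k → x k ≡ g (suc (toℕ k))) → (∀ k → r < k → g k ≡ 0ℤ) → ∀ j → coordN x (suc j) ≡ g (suc j)
coordN-suc-unique {zero}  x g _  g-beyond j       = sym (g-beyond (suc j) (s≤s z≤n))
coordN-suc-unique {suc r} x g gx _        zero    = gx fzero
coordN-suc-unique {suc r} x g gx g-beyond (suc j) =
  coordN-suc-unique (x ∘ fsuc) (g ∘ suc) (gx ∘ fsuc) (λ k r<k → g-beyond (suc k) (s≤s r<k)) j

coordN-unique : ∀ {r} (x : Weight r) (g : ℕ → ℤ) → g 0 ≡ 0ℤ →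
  (∀ k → x k ≡ g (suc (toℕ k))) → (∀ k → r < k → g k ≡ 0ℤ) → ∀ j → coordN x j ≡ g j
coordN-unique x g g0 gx g-beyond zero    = trans (coordN-zero x) (sym g0)
coordN-unique x g g0 gx g-beyond (suc j) = coordN-suc-unique x g gx g-beyond j

coordN-⊖ : ∀ {r} (x y : Weight r) k → coordN (x ⊖ y) k ≡ coordN x k - coordN y k
coordN-⊖ {zero}  x y k             = refl
coordN-⊖ {suc r} x y zero          = refl
coordN-⊖ {suc r} x y (suc zero)    = refl
coordN-⊖ {suc r} x y (suc (suc k)) = coordN-⊖ (x ∘ fsuc) (y ∘ fsuc) (suc k)

εcoord : ∀ {r} → Weight r → ℕ → ℤ
εcoord x j = coordN x (suc j) - coordN x j

sumBelow : (ℕ → ℤ) → ℕ → ℤ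
sumBelow f zero    = 0ℤ
sumBelow f (suc k) = sumBelow f k + f k

sumBelow-cong : ∀ (f g : ℕ → ℤ) k → (∀ j → j < k → f j ≡ g j) → sumBelow f k ≡ sumBelow g k
sumBelow-cong f g zero    f≗g = refl
sumBelow-cong f g (suc k) f≗g =
  cong₂ _+_ (sumBelow-cong f g k (λ j j<k → f≗g j (ℕₚ.m<n⇒m<1+n j<k))) (f≗g k ℕₚ.≤-refl)

sumBelow-antitone : ∀ (f : ℕ → ℤ) {k} n → k ≤ n → (∀ j → k ≤ j → j < n → f j ≤ℤ 0ℤ) →
  sumBelow f n ≤ℤ sumBelow f k
sumBelow-antitone f zero    z≤n _ = ℤₚ.≤-refl
sumBelow-antitone f (suc n) k≤1+n f≤0 with ℕₚ.m≤n⇒m<n∨m≡n k≤1+n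
... | inj₂ refl = ℤₚ.≤-refl
... | inj₁ k<1+n =
  ℤₚ.≤-trans step (sumBelow-antitone f n k≤n (λ j k≤j j<n → f≤0 j k≤j (ℕₚ.m<n⇒m<1+n j<n)))
  where
  k≤n = ℕₚ.≤-pred k<1+n
  step : sumBelow f n + f n ≤ℤ sumBelow f n
  step = subst (sumBelow f n + f n ≤ℤ_) (ℤₚ.+-identityʳ (sumBelow f n))
               (ℤₚ.+-monoʳ-≤ (sumBelow f n) (f≤0 n k≤n ℕₚ.≤-refl))

sumBelow-stable : ∀ (f : ℕ → ℤ) {k} n → k ≤ n → (∀ j → k ≤ j → j < n → f j ≡ 0ℤ) →
  sumBelow f n ≡ sumBelow f k
sumBelow-stable f zero    z≤n _ = refl
sumBelow-stable f {k} (suc n) k≤1+n f≡0 with ℕₚ.m≤n⇒m<n∨m≡n k≤1+n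
... | inj₂ refl = refl
... | inj₁ k<1+n = begin
  sumBelow f n + f n   ≡⟨ cong (λ z → sumBelow f n + z) (f≡0 n k≤n ℕₚ.≤-refl) ⟩
  sumBelow f n + 0ℤ    ≡⟨ ℤₚ.+-identityʳ (sumBelow f n) ⟩
  sumBelow f n         ≡⟨ sumBelow-stable f n k≤n (λ j k≤j j<n → f≡0 j k≤j (ℕₚ.m<n⇒m<1+n j<n)) ⟩
  sumBelow f k         ∎
  where
  open ≡-Reasoning
  k≤n = ℕₚ.≤-pred k<1+n

coordN≡sumBelow-εcoord : ∀ {r} (x : Weight r) k → coordN x k ≡ sumBelow (εcoord x) k
coordN≡sumBelow-εcoord x zero    = coordN-zero x
coordN≡sumBelow-εcoord x (suc k) = begin
  coordN x (suc k)                      ≡⟨ a≡b+[a-b] (coordN x (suc k)) (coordN x k) ⟩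
  coordN x k + εcoord x k               ≡⟨ cong (_+ εcoord x k) (coordN≡sumBelow-εcoord x k) ⟩
  sumBelow (εcoord x) k + εcoord x k    ∎
  where
  open ≡-Reasoning
  a≡b+[a-b] : ∀ a b → a ≡ b + (a - b)
  a≡b+[a-b] = solve-∀

εcoord-injective : ∀ {r} (x y : Weight r) → (∀ j → j < r → εcoord x j ≡ εcoord y j) → ∀ k → x k ≡ y k
εcoord-injective x y εx≗εy k = begin
  x k                                      ≡⟨ coordN-toℕ x k ⟩
  coordN x (suc (toℕ k))                   ≡⟨ coordN≡sumBelow-εcoord x (suc (toℕ k)) ⟩
  sumBelow (εcoord x) (suc (toℕ k))        ≡⟨ sumBelow-cong _ _ (suc (toℕ k)) below ⟩
  sumBelow (εcoord y) (suc (toℕ k))        ≡⟨ coordN≡sumBelow-εcoord y (suc (toℕ k)) ⟨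
  coordN y (suc (toℕ k))                   ≡⟨ coordN-toℕ y k ⟨
  y k                                      ∎
  where
  open ≡-Reasoning
  below : ∀ j → j < suc (toℕ k) → εcoord x j ≡ εcoord y j
  below j j≤k = εx≗εy j (ℕₚ.≤-<-trans (ℕₚ.≤-pred j≤k) (Finₚ.toℕ<n k))

swap : ℕ → ℕ → ℕ
swap zero    zero          = 1
swap zero    (suc zero)    = 0
swap zero    (suc (suc j)) = suc (suc j)
swap (suc a) zero          = 0
swap (suc a) (suc j)       = suc (swap a j)

swap-self : ∀ a → swap a a ≡ suc a
swap-self zero    = refl
swap-self (suc a) = cong suc (swap-self a)

swap-suc : ∀ a → swap a (suc a) ≡ a
swap-suc zero    = refl
swap-suc (suc a) = cong suc (swap-suc a)

swap-other : ∀ a j → j ≢ a → j ≢ suc a → swap a j ≡ j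
swap-other zero    zero          j≢a _     = ⊥-elim (j≢a refl)
swap-other zero    (suc zero)    _   j≢1+a = ⊥-elim (j≢1+a refl)
swap-other zero    (suc (suc j)) _   _     = refl
swap-other (suc a) zero          _   _     = refl
swap-other (suc a) (suc j)       j≢a j≢1+a =
  cong suc (swap-other a j (j≢a ∘ cong suc) (j≢1+a ∘ cong suc))

swap-involutive : ∀ a j → swap a (swap a j) ≡ j
swap-involutive zero    zero          = refl
swap-involutive zero    (suc zero)    = refl
swap-involutive zero    (suc (suc j)) = refl
swap-involutive (suc a) zero          = refl
swap-involutive (suc a) (suc j)       = cong suc (swap-involutive a j)

swap-≤ : ∀ {a j r} → a < r → j ≤ r → swap a j ≤ r
swap-≤ {zero}  {zero}        a<r _   = a<r
swap-≤ {zero}  {suc zero}    _   _   = z≤n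
swap-≤ {zero}  {suc (suc j)} _   j≤r = j≤r
swap-≤ {suc a} {zero}        _   _   = z≤n
swap-≤ {suc a} {suc j}       (s≤s a<r) (s≤s j≤r) = s≤s (swap-≤ a<r j≤r)

injective-fixed : ∀ (π : ℕ → ℕ) → (∀ {a b} → π a ≡ π b → a ≡ b) → ∀ {k r} →
  (∀ j → k < j → j ≤ r → π j ≡ j) → k ≤ π k → π k ≤ r → π k ≡ k
injective-fixed π π-injective fixed k≤πk πk≤r with ℕₚ.m≤n⇒m<n∨m≡n k≤πk
... | inj₁ k<πk = π-injective (fixed _ k<πk πk≤r)
... | inj₂ k≡πk = sym k≡πk

reflectCoord : ∀ {r} → Weight r → ℕ → ℕ → ℤ
reflectCoord x a k =
  if k ≡ᵇ suc a then (coordN x a + coordN x (suc (suc a))) - coordN x k else coordN x k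

reflectCoord-at : ∀ {r} (x : Weight r) a →
  reflectCoord x a (suc a) ≡ (coordN x a + coordN x (suc (suc a))) - coordN x (suc a)
reflectCoord-at x a rewrite dec-true (a ≟ a) refl = refl

reflectCoord-off : ∀ {r} (x : Weight r) a k → k ≢ suc a → reflectCoord x a k ≡ coordN x k
reflectCoord-off x a k k≢1+a rewrite dec-false (k ≟ suc a) k≢1+a = refl

coordN-sN : ∀ {r} a → a < r → (x : Weight r) → ∀ k → coordN (sN (suc a) x) k ≡ reflectCoord x a k
coordN-sN {r} a a<r x = coordN-unique (sN (suc a) x) (reflectCoord x a) (coordN-zero x) sN≗ beyond
  where
  sN≗ : ∀ k → sN (suc a) x k ≡ reflectCoord x a (suc (toℕ k))
  sN≗ k = cong (λ c → if suc (toℕ k) ≡ᵇ suc a then (coordN x a + coordN x (suc (suc a))) - c else c)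
               (coordN-toℕ x k)
  beyond : ∀ k → r < k → reflectCoord x a k ≡ 0ℤ
  beyond k r<k = trans (reflectCoord-off x a k (λ { refl → ℕₚ.<⇒≱ a<r (ℕₚ.≤-pred r<k) }))
                       (coordN-beyond x k r<k)

reflectCoord-step : ∀ {r} (x : Weight r) a j →
  reflectCoord x a (suc j) - reflectCoord x a j ≡ εcoord x (swap a j)
reflectCoord-step x a j with j ≟ a | j ≟ suc a
... | yes refl | _ = begin
  reflectCoord x a (suc a) - reflectCoord x a a
    ≡⟨ cong₂ _-_ (reflectCoord-at x a) (reflectCoord-off x a a (ℕₚ.1+n≢n ∘ sym)) ⟩
  ((p + q) - o) - p                 ≡⟨ reflect-left p o q ⟩
  q - o                             ≡⟨ cong (εcoord x) (swap-self a) ⟨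
  εcoord x (swap a a)               ∎
  where
  open ≡-Reasoning
  p = coordN x a
  o = coordN x (suc a)
  q = coordN x (suc (suc a))
  reflect-left : ∀ p o q → ((p + q) - o) - p ≡ q - o
  reflect-left = solve-∀
... | no _ | yes refl = begin
  reflectCoord x a (suc (suc a)) - reflectCoord x a (suc a)
    ≡⟨ cong₂ _-_ (reflectCoord-off x a (suc (suc a)) ℕₚ.1+n≢n) (reflectCoord-at x a) ⟩
  q - ((p + q) - o)                 ≡⟨ reflect-right p o q ⟩
  o - p                             ≡⟨ cong (εcoord x) (swap-suc a) ⟨
  εcoord x (swap a (suc a))         ∎
  where
  open ≡-Reasoning
  p = coordN x a
  o = coordN x (suc a)
  q = coordN x (suc (suc a))
  reflect-right : ∀ p o q → q - ((p + q) - o) ≡ o - p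
  reflect-right = solve-∀
... | no j≢a | no j≢1+a = trans
  (cong₂ _-_ (reflectCoord-off x a (suc j) (j≢a ∘ ℕₚ.suc-injective)) (reflectCoord-off x a j j≢1+a))
  (cong (εcoord x) (sym (swap-other a j j≢a j≢1+a)))

εcoord-sN : ∀ {r} a → a < r → (x : Weight r) → ∀ j → εcoord (sN (suc a) x) j ≡ εcoord x (swap a j)
εcoord-sN a a<r x j =
  trans (cong₂ _-_ (coordN-sN a a<r x (suc j)) (coordN-sN a a<r x j)) (reflectCoord-step x a j)

wordPerm : ∀ {r} → List (Fin r) → ℕ → ℕ
wordPerm []      j = j
wordPerm (t ∷ w) j = wordPerm w (swap (toℕ t) j)

εcoord-act : ∀ {r} (w : List (Fin r)) (x : Weight r) j → εcoord (act w x) j ≡ εcoord x (wordPerm w j)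
εcoord-act []      x j = refl
εcoord-act (t ∷ w) x j =
  trans (εcoord-sN (toℕ t) (Finₚ.toℕ<n t) (act w x) j) (εcoord-act w x (swap (toℕ t) j))

wordPerm-injective : ∀ {r} (w : List (Fin r)) {a b} → wordPerm w a ≡ wordPerm w b → a ≡ b
wordPerm-injective []      eq = eq
wordPerm-injective (t ∷ w) {a} {b} eq = begin
  a                              ≡⟨ swap-involutive (toℕ t) a ⟨
  swap (toℕ t) (swap (toℕ t) a)  ≡⟨ cong (swap (toℕ t)) (wordPerm-injective w eq) ⟩
  swap (toℕ t) (swap (toℕ t) b)  ≡⟨ swap-involutive (toℕ t) b ⟩
  b                              ∎
  where open ≡-Reasoning

wordPerm-≤ : ∀ {r} (w : List (Fin r)) {j} → j ≤ r → wordPerm w j ≤ r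
wordPerm-≤ []      j≤r = j≤r
wordPerm-≤ (t ∷ w) j≤r = wordPerm-≤ w (swap-≤ (Finₚ.toℕ<n t) j≤r)

wordPerm-pos : ∀ {r} (w : List (Fin r)) {j} → wordPerm w 0 ≡ 0 → 1 ≤ j → 1 ≤ wordPerm w j
wordPerm-pos w {suc j} π0≡0 _ with wordPerm w (suc j) in πj≡
... | suc _ = s≤s z≤n
... | zero  = ⊥-elim (ℕₚ.1+n≢0 (wordPerm-injective w (trans πj≡ (sym π0≡0))))

wordPerm-< : ∀ {r} (w : List (Fin r)) N → (∀ j → N ≤ j → j ≤ r → wordPerm w j ≡ j) →
  ∀ {j} → j < N → j ≤ r → wordPerm w j < N
wordPerm-< w N fixed {j} j<N j≤r with wordPerm w j <? N
... | yes πj<N = πj<N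
... | no  πj≮N = ⊥-elim (ℕₚ.<⇒≱ j<N (subst (N ≤_) πj≡j N≤πj))
  where
  N≤πj = ℕₚ.≮⇒≥ πj≮N
  πj≡j : wordPerm w j ≡ j
  πj≡j = wordPerm-injective w (fixed (wordPerm w j) N≤πj (wordPerm-≤ w j≤r))

act-cong : ∀ {r} (w w′ : List (Fin r)) → (∀ j → j < r → wordPerm w j ≡ wordPerm w′ j) → act w ≈W act w′
act-cong w w′ π≗π′ x = εcoord-injective (act w x) (act w′ x) λ j j<r → begin
  εcoord (act w x) j         ≡⟨ εcoord-act w x j ⟩
  εcoord x (wordPerm w j)    ≡⟨ cong (εcoord x) (π≗π′ j j<r) ⟩
  εcoord x (wordPerm w′ j)   ≡⟨ εcoord-act w′ x j ⟨
  εcoord (act w′ x) j        ∎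
  where open ≡-Reasoning

finSum-cong : ∀ {n} (f g : Fin n → ℤ) → (∀ i → f i ≡ g i) → finSum f ≡ finSum g
finSum-cong {zero}  f g f≗g = refl
finSum-cong {suc n} f g f≗g = cong₂ _+_ (f≗g fzero) (finSum-cong (f ∘ fsuc) (g ∘ fsuc) (f≗g ∘ fsuc))

finSum-zero : ∀ {n} (f : Fin n → ℤ) → (∀ i → f i ≡ 0ℤ) → finSum f ≡ 0ℤ
finSum-zero {zero}  f f≗0 = refl
finSum-zero {suc n} f f≗0 rewrite f≗0 fzero | finSum-zero (f ∘ fsuc) (f≗0 ∘ fsuc) = refl

finSum-distrib-- : ∀ {n} (f g : Fin n → ℤ) → finSum (λ i → f i - g i) ≡ finSum f - finSum g
finSum-distrib-- {zero}  f g = refl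
finSum-distrib-- {suc n} f g
  rewrite finSum-distrib-- (f ∘ fsuc) (g ∘ fsuc) = interchange (f fzero) (g fzero) _ _
  where
  interchange : ∀ a b c d → a - b + (c - d) ≡ a + c - (b + d)
  interchange = solve-∀

finSum-*ˡ : ∀ {n} c (f : Fin n → ℤ) → finSum (λ i → c * f i) ≡ c * finSum f
finSum-*ˡ {zero}  c f = sym (ℤₚ.*-zeroʳ c)
finSum-*ˡ {suc n} c f
  rewrite finSum-*ˡ c (f ∘ fsuc) = sym (ℤₚ.*-distribˡ-+ c (f fzero) _)

finSum-pos : ∀ {n} (f : Fin n → ℕ) → finSum (λ i → + f i) ≡ + finSumℕ f
finSum-pos {zero}  f = refl
finSum-pos {suc n} f rewrite finSum-pos (f ∘ fsuc) = sym (ℤₚ.pos-+ (f fzero) _)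

+[m∸n]≡+m-+n : ∀ {m n} → n ≤ m → + (m ∸ n) ≡ + m - + n
+[m∸n]≡+m-+n {m} {n} n≤m = trans (sym (ℤₚ.⊖-≥ n≤m)) (sym (ℤₚ.m-n≡m⊖n m n))

-- fundW r i extended to every index k : ℕ, so that fundW r i k = fundCoord r i (suc (toℕ k)).
fundCoord : ℕ → ℕ → ℕ → ℤ
fundCoord r i k = if k ≤ᵇ i then + ((suc r ∸ i) *ℕ k) else + (i *ℕ (suc r ∸ k))

fundCoord-≤ : ∀ r {i k} → k ≤ i → fundCoord r i k ≡ + (suc r ∸ i) * + k
fundCoord-≤ r {i} {k} k≤i rewrite dec-true (k ≤? i) k≤i = ℤₚ.pos-* (suc r ∸ i) k

fundCoord-> : ∀ r {i k} → i < k → fundCoord r i k ≡ + i * + (suc r ∸ k)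
fundCoord-> r {i} {k} i<k rewrite dec-false (k ≤? i) (ℕₚ.<⇒≱ i<k) = ℤₚ.pos-* i (suc r ∸ k)

fundCoord-zero : ∀ r i → fundCoord r i 0 ≡ 0ℤ
fundCoord-zero r i = cong +_ (ℕₚ.*-zeroʳ (suc r ∸ i))

fundCoord-beyond : ∀ r {i k} → i ≤ r → r < k → fundCoord r i k ≡ 0ℤ
fundCoord-beyond r {i} {k} i≤r r<k
  rewrite fundCoord-> r (ℕₚ.≤-<-trans i≤r r<k) | ℕₚ.m≤n⇒m∸n≡0 r<k = ℤₚ.*-zeroʳ (+ i)

⟦_≤_⟧ : ℕ → ℕ → ℤ
⟦ zero  ≤ i     ⟧ = + 1
⟦ suc j ≤ zero  ⟧ = 0ℤ
⟦ suc j ≤ suc i ⟧ = ⟦ j ≤ i ⟧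

⟦≤⟧-yes : ∀ {j i} → j ≤ i → ⟦ j ≤ i ⟧ ≡ + 1
⟦≤⟧-yes z≤n       = refl
⟦≤⟧-yes (s≤s j≤i) = ⟦≤⟧-yes j≤i

⟦≤⟧-no : ∀ {j i} → i < j → ⟦ j ≤ i ⟧ ≡ 0ℤ
⟦≤⟧-no {suc j} {zero}  _         = refl
⟦≤⟧-no {suc j} {suc i} (s≤s i<j) = ⟦≤⟧-no i<j

-- The ε_{j+1}-coefficient of ϖ_{t+1} is [j ≤ t] − (t+1)/(r+1).
fundCoord-step : ∀ r t j → t < r → j ≤ r →
  fundCoord r (suc t) (suc j) - fundCoord r (suc t) j ≡ + suc r * ⟦ j ≤ t ⟧ - + suc t
fundCoord-step r t j t<r j≤r with ℕₚ.<-cmp j (suc t)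
... | tri< j<1+t _ _ = begin
  fundCoord r (suc t) (suc j) - fundCoord r (suc t) j
    ≡⟨ cong₂ _-_ (fundCoord-≤ r j<1+t) (fundCoord-≤ r (ℕₚ.<⇒≤ j<1+t)) ⟩
  + (suc r ∸ suc t) * (+ 1 + + j) - + (suc r ∸ suc t) * + j
    ≡⟨ cong (λ d → d * (+ 1 + + j) - d * + j) (+[m∸n]≡+m-+n (s≤s (ℕₚ.<⇒≤ t<r))) ⟩
  (+ suc r - + suc t) * (+ 1 + + j) - (+ suc r - + suc t) * + j
    ≡⟨ below (+ suc r) (+ suc t) (+ j) ⟩
  + suc r * + 1 - + suc t
    ≡⟨ cong (λ b → + suc r * b - + suc t) (⟦≤⟧-yes (ℕₚ.≤-pred j<1+t)) ⟨
  + suc r * ⟦ j ≤ t ⟧ - + suc t ∎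
  where
  open ≡-Reasoning
  below : ∀ N T J → (N - T) * (+ 1 + J) - (N - T) * J ≡ N * + 1 - T
  below = solve-∀
... | tri≈ _ refl _ = begin
  fundCoord r (suc t) (suc (suc t)) - fundCoord r (suc t) (suc t)
    ≡⟨ cong₂ _-_ (fundCoord-> r {suc t} ℕₚ.≤-refl) (fundCoord-≤ r {suc t} ℕₚ.≤-refl) ⟩
  + suc t * + (suc r ∸ suc (suc t)) - + (suc r ∸ suc t) * + suc t
    ≡⟨ cong₂ (λ a b → + suc t * a - b * + suc t)
             (+[m∸n]≡+m-+n (s≤s t<r)) (+[m∸n]≡+m-+n (s≤s (ℕₚ.<⇒≤ t<r))) ⟩
  + suc t * (+ suc r - (+ 1 + + suc t)) - (+ suc r - + suc t) * + suc t
    ≡⟨ at (+ suc r) (+ suc t) ⟩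
  + suc r * 0ℤ - + suc t
    ≡⟨ cong (λ b → + suc r * b - + suc t) (⟦≤⟧-no {suc t} {t} ℕₚ.≤-refl) ⟨
  + suc r * ⟦ suc t ≤ t ⟧ - + suc t ∎
  where
  open ≡-Reasoning
  at : ∀ N T → T * (N - (+ 1 + T)) - (N - T) * T ≡ N * 0ℤ - T
  at = solve-∀
... | tri> _ _ 1+t<j = begin
  fundCoord r (suc t) (suc j) - fundCoord r (suc t) j
    ≡⟨ cong₂ _-_ (fundCoord-> r (ℕₚ.m<n⇒m<1+n 1+t<j)) (fundCoord-> r 1+t<j) ⟩
  + suc t * + (suc r ∸ suc j) - + suc t * + (suc r ∸ j)
    ≡⟨ cong₂ (λ a b → + suc t * a - + suc t * b)
             (+[m∸n]≡+m-+n (s≤s j≤r)) (+[m∸n]≡+m-+n (ℕₚ.m≤n⇒m≤1+n j≤r)) ⟩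
  + suc t * (+ suc r - (+ 1 + + j)) - + suc t * (+ suc r - + j)
    ≡⟨ above (+ suc r) (+ suc t) (+ j) ⟩
  + suc r * 0ℤ - + suc t
    ≡⟨ cong (λ b → + suc r * b - + suc t) (⟦≤⟧-no (ℕₚ.<-trans ℕₚ.≤-refl 1+t<j)) ⟨
  + suc r * ⟦ j ≤ t ⟧ - + suc t ∎
  where
  open ≡-Reasoning
  above : ∀ N T J → T * (N - (+ 1 + J)) - T * (N - J) ≡ N * 0ℤ - T
  above = solve-∀

tailSum : ∀ {r} → (Fin r → ℕ) → ℕ → ℕ
tailSum {zero}  c j       = 0
tailSum {suc r} c zero    = c fzero +ℕ tailSum (c ∘ fsuc) zero
tailSum {suc r} c (suc j) = tailSum (c ∘ fsuc) j

finSum-⟦≤⟧ : ∀ {r} (c : Fin r → ℕ) j → finSum (λ i → + c i * ⟦ j ≤ toℕ i ⟧) ≡ + tailSum c j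
finSum-⟦≤⟧ {zero}  c j = refl
finSum-⟦≤⟧ {suc r} c zero
  rewrite finSum-⟦≤⟧ (c ∘ fsuc) zero | ℤₚ.*-identityʳ (+ c fzero) = sym (ℤₚ.pos-+ (c fzero) _)
finSum-⟦≤⟧ {suc r} c (suc j)
  rewrite finSum-⟦≤⟧ (c ∘ fsuc) j | ℤₚ.*-zeroʳ (+ c fzero) = ℤₚ.+-identityˡ _

ones : ∀ {r} → Fin r → ℕ
ones _ = 1

tailSum-ones : ∀ r j → tailSum (ones {r}) j ≡ r ∸ j
tailSum-ones zero    j       = sym (ℕₚ.0∸n≡0 j)
tailSum-ones (suc r) zero    = cong suc (tailSum-ones r zero)
tailSum-ones (suc r) (suc j) = tailSum-ones r j

tailSum-beyond : ∀ {r} (c : Fin r → ℕ) j → r ≤ j → tailSum c j ≡ 0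
tailSum-beyond {zero}  c j       _         = refl
tailSum-beyond {suc r} c (suc j) (s≤s r≤j) = tailSum-beyond (c ∘ fsuc) j r≤j

tailSum-suc : ∀ {r} (m : Fin r → ℕ) j → tailSum m j ≡ mAt m (suc j) +ℕ tailSum m (suc j)
tailSum-suc {zero}  m j       = refl
tailSum-suc {suc r} m zero    = refl
tailSum-suc {suc r} m (suc j) = tailSum-suc (m ∘ fsuc) j

mAt-tail : ∀ {r} (m : Fin (suc r) → ℕ) {N} → (∀ j → suc N < j → mAt m j ≡ 0) →
  ∀ j → N < j → mAt (m ∘ fsuc) j ≡ 0
mAt-tail m m≡0 (suc j) N<1+j = m≡0 (suc (suc j)) (s≤s N<1+j)

tailSum-vanish : ∀ {r} (m : Fin r → ℕ) N → (∀ j → N < j → mAt m j ≡ 0) →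
  ∀ j → N ≤ j → tailSum m j ≡ 0
tailSum-vanish {zero}  m N       _   j       _         = refl
tailSum-vanish {suc r} m zero    m≡0 zero    _         =
  cong₂ _+ℕ_ (m≡0 1 ℕₚ.≤-refl)
             (tailSum-vanish (m ∘ fsuc) zero (mAt-tail m (λ j 1<j → m≡0 j (ℕₚ.<⇒≤ 1<j))) zero z≤n)
tailSum-vanish {suc r} m zero    m≡0 (suc j) _         =
  tailSum-vanish (m ∘ fsuc) zero (mAt-tail m (λ j 1<j → m≡0 j (ℕₚ.<⇒≤ 1<j))) j z≤n
tailSum-vanish {suc r} m (suc N) m≡0 (suc j) (s≤s N≤j) = tailSum-vanish (m ∘ fsuc) N (mAt-tail m m≡0) j N≤j

fundCombination : ∀ r → (Fin r → ℕ) → ℕ → ℤ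
fundCombination r c k = finSum (λ (i : Fin r) → + c i * fundCoord r (suc (toℕ i)) k)

fundCombination-zero : ∀ r (c : Fin r → ℕ) → fundCombination r c 0 ≡ 0ℤ
fundCombination-zero r c =
  finSum-zero _ (λ i → trans (cong (+ c i *_) (fundCoord-zero r (suc (toℕ i)))) (ℤₚ.*-zeroʳ (+ c i)))

fundCombination-beyond : ∀ r (c : Fin r → ℕ) k → r < k → fundCombination r c k ≡ 0ℤ
fundCombination-beyond r c k r<k =
  finSum-zero _ (λ i → trans (cong (+ c i *_) (fundCoord-beyond r (Finₚ.toℕ<n i) r<k)) (ℤₚ.*-zeroʳ (+ c i)))

fundCombination-step : ∀ r (c : Fin r → ℕ) j → j ≤ r →
  fundCombination r c (suc j) - fundCombination r c j ≡ + suc r * + tailSum c j - + wsum c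
fundCombination-step r c j j≤r = begin
  fundCombination r c (suc j) - fundCombination r c j
    ≡⟨ finSum-distrib-- (λ i → + c i * D i (suc j)) (λ i → + c i * D i j) ⟨
  finSum (λ i → + c i * D i (suc j) - + c i * D i j)
    ≡⟨ finSum-cong _ _ term ⟩
  finSum (λ i → N * (+ c i * ⟦ j ≤ toℕ i ⟧) - + (suc (toℕ i) *ℕ c i))
    ≡⟨ finSum-distrib-- (λ i → N * (+ c i * ⟦ j ≤ toℕ i ⟧)) (λ i → + (suc (toℕ i) *ℕ c i)) ⟩
  finSum (λ i → N * (+ c i * ⟦ j ≤ toℕ i ⟧)) - finSum (λ i → + (suc (toℕ i) *ℕ c i))
    ≡⟨ cong₂ _-_ (trans (finSum-*ˡ N (λ i → + c i * ⟦ j ≤ toℕ i ⟧)) (cong (N *_) (finSum-⟦≤⟧ c j)))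
                 (finSum-pos (λ i → suc (toℕ i) *ℕ c i)) ⟩
  N * + tailSum c j - + wsum c ∎
  where
  open ≡-Reasoning
  N = + suc r
  D : Fin r → ℕ → ℤ
  D i = fundCoord r (suc (toℕ i))
  term : ∀ i → + c i * D i (suc j) - + c i * D i j ≡ N * (+ c i * ⟦ j ≤ toℕ i ⟧) - + (suc (toℕ i) *ℕ c i)
  term i = begin
    C * D i (suc j) - C * D i j          ≡⟨ factor C (D i (suc j)) (D i j) ⟩
    C * (D i (suc j) - D i j)            ≡⟨ cong (C *_) (fundCoord-step r (toℕ i) j (Finₚ.toℕ<n i) j≤r) ⟩
    C * (N * ⟦ j ≤ toℕ i ⟧ - + suc (toℕ i)) ≡⟨ expand C N ⟦ j ≤ toℕ i ⟧ (+ suc (toℕ i)) ⟩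
    N * (C * ⟦ j ≤ toℕ i ⟧) - + suc (toℕ i) * C
      ≡⟨ cong (N * (C * ⟦ j ≤ toℕ i ⟧) -_) (ℤₚ.pos-* (suc (toℕ i)) (c i)) ⟨
    N * (C * ⟦ j ≤ toℕ i ⟧) - + (suc (toℕ i) *ℕ c i) ∎
    where
    C = + c i
    factor : ∀ C a b → C * a - C * b ≡ C * (a - b)
    factor = solve-∀
    expand : ∀ C N I S → C * (N * I - S) ≡ N * (C * I) - S * C
    expand = solve-∀

triangle : ℕ → ℕ
triangle r = wsum (ones {r})

lamRhoW : ∀ r → ℕ → Weight r
lamRhoW r ℓ = lambdaW r ℓ ⊕ rhoW r

muRhoW : ∀ r → (Fin r → ℕ) → Weight r
muRhoW r m = muW r m ⊕ rhoW r

-- Up to a multiple of ε_1 + ⋯ + ε_{r+1}, λ + ρ = (ℓ + r, r − 1, r − 2, …, 0) and the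
-- ε_{j+1}-coordinate of μ + ρ is m_{j+1} + ⋯ + m_r + (r − j).
lamRhoε : ℕ → ℕ → ℕ → ℕ
lamRhoε r ℓ zero    = ℓ +ℕ r
lamRhoε r ℓ (suc p) = r ∸ suc p

muRhoε : ∀ {r} → (Fin r → ℕ) → ℕ → ℕ
muRhoε {r} m j = tailSum m j +ℕ (r ∸ j)

rhoW≡fundCombination-ones : ∀ r (k : Fin r) → rhoW r k ≡ fundCombination r ones (suc (toℕ k))
rhoW≡fundCombination-ones r k =
  finSum-cong (λ (i : Fin r) → fundW r (suc (toℕ i)) k) _ (λ i → sym (ℤₚ.*-identityˡ _))

coordN-lamRhoW : ∀ r ℓ → 1 ≤ r → ∀ k →
  coordN (lamRhoW r ℓ) k ≡ + ℓ * fundCoord r 1 k + fundCombination r ones k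
coordN-lamRhoW r ℓ 1≤r = coordN-unique (lamRhoW r ℓ) g at-zero pointwise beyond
  where
  g : ℕ → ℤ
  g k = + ℓ * fundCoord r 1 k + fundCombination r ones k
  vanish : ∀ {a b} → a ≡ 0ℤ → b ≡ 0ℤ → + ℓ * a + b ≡ 0ℤ
  vanish refl refl = cong (_+ 0ℤ) (ℤₚ.*-zeroʳ (+ ℓ))
  at-zero : g 0 ≡ 0ℤ
  at-zero = vanish (fundCoord-zero r 1) (fundCombination-zero r ones)
  pointwise : ∀ k → lamRhoW r ℓ k ≡ g (suc (toℕ k))
  pointwise k = cong (λ z → lambdaW r ℓ k + z) (rhoW≡fundCombination-ones r k)
  beyond : ∀ k → r < k → g k ≡ 0ℤ
  beyond k r<k = vanish (fundCoord-beyond r 1≤r r<k) (fundCombination-beyond r ones k r<k)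

coordN-muRhoW : ∀ r m k → coordN (muRhoW r m) k ≡ fundCombination r m k + fundCombination r ones k
coordN-muRhoW r m = coordN-unique (muRhoW r m) g at-zero pointwise beyond
  where
  g : ℕ → ℤ
  g k = fundCombination r m k + fundCombination r ones k
  vanish : ∀ {a b} → a ≡ 0ℤ → b ≡ 0ℤ → a + b ≡ 0ℤ
  vanish refl refl = refl
  at-zero : g 0 ≡ 0ℤ
  at-zero = vanish (fundCombination-zero r m) (fundCombination-zero r ones)
  pointwise : ∀ k → muRhoW r m k ≡ g (suc (toℕ k))
  pointwise k = cong (λ z → muW r m k + z) (rhoW≡fundCombination-ones r k)
  beyond : ∀ k → r < k → g k ≡ 0ℤ
  beyond k r<k = vanish (fundCombination-beyond r m k r<k) (fundCombination-beyond r ones k r<k)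

fundCombination-ones-step : ∀ r j → j ≤ r →
  fundCombination r ones (suc j) - fundCombination r ones j ≡ + suc r * + (r ∸ j) - + triangle r
fundCombination-ones-step r j j≤r =
  trans (fundCombination-step r ones j j≤r) (cong (λ t → + suc r * + t - + triangle r) (tailSum-ones r j))

lamRhoε≡ : ∀ r ℓ p → + lamRhoε r ℓ p ≡ + ℓ * ⟦ p ≤ 0 ⟧ + + (r ∸ p)
lamRhoε≡ r ℓ zero    = trans (ℤₚ.pos-+ ℓ r) (cong (_+ + r) (sym (ℤₚ.*-identityʳ (+ ℓ))))
lamRhoε≡ r ℓ (suc p) = trans (sym (ℤₚ.+-identityˡ _)) (cong (_+ + (r ∸ suc p)) (sym (ℤₚ.*-zeroʳ (+ ℓ))))

εcoord-lamRhoW : ∀ r ℓ → 1 ≤ r → ∀ p → p ≤ r →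
  εcoord (lamRhoW r ℓ) p ≡ + suc r * + lamRhoε r ℓ p - (+ ℓ + + triangle r)
εcoord-lamRhoW r ℓ 1≤r p p≤r = begin
  εcoord (lamRhoW r ℓ) p
    ≡⟨ cong₂ _-_ (coordN-lamRhoW r ℓ 1≤r (suc p)) (coordN-lamRhoW r ℓ 1≤r p) ⟩
  (+ ℓ * F (suc p) + R (suc p)) - (+ ℓ * F p + R p)
    ≡⟨ regroup (+ ℓ) (F (suc p)) (F p) (R (suc p)) (R p) ⟩
  + ℓ * (F (suc p) - F p) + (R (suc p) - R p)
    ≡⟨ cong₂ (λ a b → + ℓ * a + b) (fundCoord-step r 0 p 1≤r p≤r) (fundCombination-ones-step r p p≤r) ⟩
  + ℓ * (N * ⟦ p ≤ 0 ⟧ - + 1) + (N * + (r ∸ p) - + triangle r)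
    ≡⟨ collect (+ ℓ) N ⟦ p ≤ 0 ⟧ (+ (r ∸ p)) (+ triangle r) ⟩
  N * (+ ℓ * ⟦ p ≤ 0 ⟧ + + (r ∸ p)) - (+ ℓ + + triangle r)
    ≡⟨ cong (λ a → N * a - (+ ℓ + + triangle r)) (lamRhoε≡ r ℓ p) ⟨
  N * + lamRhoε r ℓ p - (+ ℓ + + triangle r) ∎
  where
  open ≡-Reasoning
  N = + suc r
  F = fundCoord r 1
  R = fundCombination r ones
  regroup : ∀ L a b c d → (L * a + c) - (L * b + d) ≡ L * (a - b) + (c - d)
  regroup = solve-∀
  collect : ∀ L N I D T → L * (N * I - + 1) + (N * D - T) ≡ N * (L * I + D) - (L + T)
  collect = solve-∀

εcoord-muRhoW : ∀ r (m : Fin r → ℕ) j → j ≤ r →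
  εcoord (muRhoW r m) j ≡ + suc r * + muRhoε m j - (+ wsum m + + triangle r)
εcoord-muRhoW r m j j≤r = begin
  εcoord (muRhoW r m) j
    ≡⟨ cong₂ _-_ (coordN-muRhoW r m (suc j)) (coordN-muRhoW r m j) ⟩
  (M (suc j) + R (suc j)) - (M j + R j)
    ≡⟨ regroup (M (suc j)) (M j) (R (suc j)) (R j) ⟩
  (M (suc j) - M j) + (R (suc j) - R j)
    ≡⟨ cong₂ _+_ (fundCombination-step r m j j≤r) (fundCombination-ones-step r j j≤r) ⟩
  (N * + tailSum m j - + wsum m) + (N * + (r ∸ j) - + triangle r)
    ≡⟨ collect N (+ tailSum m j) (+ (r ∸ j)) (+ wsum m) (+ triangle r) ⟩
  N * (+ tailSum m j + + (r ∸ j)) - (+ wsum m + + triangle r)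
    ≡⟨ cong (λ a → N * a - (+ wsum m + + triangle r)) (ℤₚ.pos-+ (tailSum m j) (r ∸ j)) ⟨
  N * + muRhoε m j - (+ wsum m + + triangle r) ∎
  where
  open ≡-Reasoning
  N = + suc r
  M = fundCombination r m
  R = fundCombination r ones
  regroup : ∀ a b c d → (a + c) - (b + d) ≡ (a - b) + (c - d)
  regroup = solve-∀
  collect : ∀ N T D W S → (N * T - W) + (N * D - S) ≡ N * (T + D) - (W + S)
  collect = solve-∀

if-pos : ∀ b → (if b then + 1 else 0ℤ) ≡ + (if b then 1 else 0)
if-pos true  = refl
if-pos false = refl

KostantPos⇒nonneg : ∀ r ξ → KostantPos r ξ → ∀ k → 0ℤ ≤ℤ ξ k
KostantPos⇒nonneg r ξ (f , _ , ξ≡) k = subst (0ℤ ≤ℤ_) (sym ξk≡) (+≤+ z≤n)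
  where
  bit : Fin r → Fin r → ℕ
  bit i j = if (toℕ i ≤ᵇ toℕ k) ∧ (toℕ k ≤ᵇ toℕ j) then 1 else 0
  S = finSumℕ (λ i → finSumℕ (λ j → f i j *ℕ bit i j))
  term : ∀ i j → + f i j * posRoot i j k ≡ + (f i j *ℕ bit i j)
  term i j = trans (cong (+ f i j *_) (if-pos _)) (sym (ℤₚ.pos-* (f i j) (bit i j)))
  row : ∀ i → finSum (λ j → + f i j * posRoot i j k) ≡ + finSumℕ (λ j → f i j *ℕ bit i j)
  row i = trans (finSum-cong _ _ (term i)) (finSum-pos (λ j → f i j *ℕ bit i j))
  ξk≡ : ξ k ≡ + (suc r *ℕ S)
  ξk≡ = begin
    ξ k                                                              ≡⟨ ξ≡ k ⟩
    + suc r * finSum (λ i → finSum (λ j → + f i j * posRoot i j k))  ≡⟨ cong (+ suc r *_) (finSum-cong _ _ row) ⟩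
    + suc r * finSum (λ i → + finSumℕ (λ j → f i j *ℕ bit i j))
      ≡⟨ cong (+ suc r *_) (finSum-pos (λ i → finSumℕ (λ j → f i j *ℕ bit i j))) ⟩
    + suc r * + S                                                    ≡⟨ ℤₚ.pos-* (suc r) S ⟨
    + (suc r *ℕ S)                                                   ∎
    where open ≡-Reasoning

finSum-single : ∀ {n} (g : Fin n → ℤ) i → (∀ j → j ≢ i → g j ≡ 0ℤ) → finSum g ≡ g i
finSum-single {suc n} g fzero    g≗0 =
  trans (cong (λ s → g fzero + s) (finSum-zero (g ∘ fsuc) (λ j → g≗0 (fsuc j) (λ ())))) (ℤₚ.+-identityʳ _)
finSum-single {suc n} g (fsuc i) g≗0 =
  trans (cong₂ _+_ (g≗0 fzero (λ ()))
                   (finSum-single (g ∘ fsuc) i (λ j j≢i → g≗0 (fsuc j) (j≢i ∘ Finₚ.suc-injective))))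
        (ℤₚ.+-identityˡ _)

posRoot-diagonal : ∀ {r} (i : Fin r) → posRoot i i i ≡ + 1
posRoot-diagonal i rewrite dec-true (toℕ i ≤? toℕ i) ℕₚ.≤-refl = refl

posRoot-off-diagonal : ∀ {r} (i k : Fin r) → i ≢ k → posRoot i i k ≡ 0ℤ
posRoot-off-diagonal i k i≢k with ℕₚ.<-cmp (toℕ i) (toℕ k)
... | tri< i<k _ _
  rewrite dec-true (toℕ i ≤? toℕ k) (ℕₚ.<⇒≤ i<k) | dec-false (toℕ k ≤? toℕ i) (ℕₚ.<⇒≱ i<k) = refl
... | tri≈ _ i≡k _ = ⊥-elim (i≢k (Finₚ.toℕ-injective i≡k))
... | tri> _ _ k<i rewrite dec-false (toℕ i ≤? toℕ k) (ℕₚ.<⇒≱ k<i) = refl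

-- Every simple root is a positive root, so a weight whose α-coordinates are
-- nonnegative integers is reached with the diagonal combination alone.
KostantPos-of-multiples : ∀ r ξ → (∀ k → Σ ℕ λ d → ξ k ≡ + suc r * + d) → KostantPos r ξ
KostantPos-of-multiples r ξ multiple = f , upper , ξ≡
  where
  d : Fin r → ℕ
  d k = proj₁ (multiple k)
  f : Fin r → Fin r → ℕ
  f i j = if toℕ i ≡ᵇ toℕ j then d i else 0
  f-off : ∀ i j → i ≢ j → f i j ≡ 0
  f-off i j i≢j rewrite dec-false (toℕ i ≟ toℕ j) (i≢j ∘ Finₚ.toℕ-injective) = refl
  f-diagonal : ∀ i → f i i ≡ d i
  f-diagonal i rewrite dec-true (toℕ i ≟ toℕ i) refl = refl
  upper : ∀ i j → toℕ j < toℕ i → f i j ≡ 0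
  upper i j j<i = f-off i j (λ { refl → ℕₚ.<-irrefl refl j<i })
  row : ∀ k i → finSum (λ j → + f i j * posRoot i j k) ≡ + d i * posRoot i i k
  row k i = trans (finSum-single _ i (λ j j≢i → trans (cong (λ n → + n * posRoot i j k) (f-off i j (j≢i ∘ sym)))
                                                       (ℤₚ.*-zeroˡ (posRoot i j k))))
                  (cong (λ n → + n * posRoot i i k) (f-diagonal i))
  column : ∀ k → finSum (λ i → + d i * posRoot i i k) ≡ + d k
  column k = trans (finSum-single _ k (λ i i≢k → trans (cong (+ d i *_) (posRoot-off-diagonal i k i≢k))
                                                       (ℤₚ.*-zeroʳ (+ d i))))
                   (trans (cong (+ d k *_) (posRoot-diagonal k)) (ℤₚ.*-identityʳ (+ d k)))
  ξ≡ : ∀ k → ξ k ≡ + suc r * finSum (λ i → finSum (λ j → + f i j * posRoot i j k))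
  ξ≡ k = trans (proj₂ (multiple k)) (cong (+ suc r *_) (sym (trans (finSum-cong _ _ (row k)) (column k))))

InAlt-cong : ∀ r ℓ m {σ σ′ : Weight r → Weight r} → σ ≈W σ′ → InAlt r ℓ m σ → InAlt r ℓ m σ′
InAlt-cong r ℓ m σ≈σ′ (f , upper , ξ≡) =
  f , upper , λ k → trans (cong (λ z → z - muRhoW r m k) (sym (σ≈σ′ (lamRhoW r ℓ) k))) (ξ≡ k)

shiftedDiff : ∀ r → ℕ → (Fin r → ℕ) → List (Fin r) → Weight r
shiftedDiff r ℓ m w = act w (lamRhoW r ℓ) ⊖ muRhoW r m

gap : ∀ r → ℕ → (Fin r → ℕ) → List (Fin r) → ℕ → ℤ
gap r ℓ m w j = + lamRhoε r ℓ (wordPerm w j) - + muRhoε m j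

scaledGap : ∀ r → ℕ → (Fin r → ℕ) → List (Fin r) → ℕ → ℤ
scaledGap r ℓ m w j = + suc r * gap r ℓ m w j + (+ wsum m - + ℓ)

εcoord-⊖ : ∀ {r} (x y : Weight r) j → εcoord (x ⊖ y) j ≡ εcoord x j - εcoord y j
εcoord-⊖ x y j = trans (cong₂ _-_ (coordN-⊖ x y (suc j)) (coordN-⊖ x y j))
                         (interchange (coordN x (suc j)) (coordN y (suc j)) (coordN x j) (coordN y j))
  where
  interchange : ∀ a b c d → (a - b) - (c - d) ≡ (a - c) - (b - d)
  interchange = solve-∀

εcoord-shiftedDiff : ∀ r ℓ m w → 1 ≤ r → ∀ j → j ≤ r → εcoord (shiftedDiff r ℓ m w) j ≡ scaledGap r ℓ m w j
εcoord-shiftedDiff r ℓ m w 1≤r j j≤r = begin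
  εcoord (shiftedDiff r ℓ m w) j
    ≡⟨ εcoord-⊖ (act w (lamRhoW r ℓ)) (muRhoW r m) j ⟩
  εcoord (act w (lamRhoW r ℓ)) j - εcoord (muRhoW r m) j
    ≡⟨ cong₂ _-_ (trans (εcoord-act w (lamRhoW r ℓ) j) (εcoord-lamRhoW r ℓ 1≤r (wordPerm w j) (wordPerm-≤ w j≤r)))
                 (εcoord-muRhoW r m j j≤r) ⟩
  (N * + lamRhoε r ℓ (wordPerm w j) - (+ ℓ + T)) - (N * + muRhoε m j - (+ wsum m + T))
    ≡⟨ collect N (+ lamRhoε r ℓ (wordPerm w j)) (+ muRhoε m j) (+ ℓ) (+ wsum m) T ⟩
  scaledGap r ℓ m w j ∎
  where
  open ≡-Reasoning
  N = + suc r
  T = + triangle r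
  collect : ∀ N A B L W T → (N * A - (L + T)) - (N * B - (W + T)) ≡ N * (A - B) + (W - L)
  collect = solve-∀

shiftedDiff≡sumBelow : ∀ r ℓ m w → 1 ≤ r → ∀ k →
  shiftedDiff r ℓ m w k ≡ sumBelow (scaledGap r ℓ m w) (suc (toℕ k))
shiftedDiff≡sumBelow r ℓ m w 1≤r k = begin
  shiftedDiff r ℓ m w k                               ≡⟨ coordN-toℕ (shiftedDiff r ℓ m w) k ⟩
  coordN (shiftedDiff r ℓ m w) (suc (toℕ k))
    ≡⟨ coordN≡sumBelow-εcoord (shiftedDiff r ℓ m w) (suc (toℕ k)) ⟩
  sumBelow (εcoord (shiftedDiff r ℓ m w)) (suc (toℕ k)) ≡⟨ sumBelow-cong _ _ (suc (toℕ k)) below ⟩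
  sumBelow (scaledGap r ℓ m w) (suc (toℕ k))          ∎
  where
  open ≡-Reasoning
  below : ∀ j → j < suc (toℕ k) → εcoord (shiftedDiff r ℓ m w) j ≡ scaledGap r ℓ m w j
  below j j≤k = εcoord-shiftedDiff r ℓ m w 1≤r j (ℕₚ.≤-trans (ℕₚ.≤-pred j≤k) (ℕₚ.<⇒≤ (Finₚ.toℕ<n k)))

sumBelow-scaledGap-total : ∀ r ℓ m w → 1 ≤ r → sumBelow (scaledGap r ℓ m w) (suc r) ≡ 0ℤ
sumBelow-scaledGap-total r ℓ m w 1≤r = begin
  sumBelow (scaledGap r ℓ m w) (suc r)                  ≡⟨ sumBelow-cong _ _ (suc r) below ⟨
  sumBelow (εcoord (shiftedDiff r ℓ m w)) (suc r)       ≡⟨ coordN≡sumBelow-εcoord (shiftedDiff r ℓ m w) (suc r) ⟨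
  coordN (shiftedDiff r ℓ m w) (suc r)
    ≡⟨ coordN-beyond (shiftedDiff r ℓ m w) (suc r) ℕₚ.≤-refl ⟩
  0ℤ                                                    ∎
  where
  open ≡-Reasoning
  below : ∀ j → j < suc r → εcoord (shiftedDiff r ℓ m w) j ≡ scaledGap r ℓ m w j
  below j j≤r = εcoord-shiftedDiff r ℓ m w 1≤r j (ℕₚ.≤-pred j≤r)

sumBelow-scaledGap-balanced : ∀ r m w k →
  sumBelow (scaledGap r (wsum m) m w) k ≡ + suc r * sumBelow (gap r (wsum m) m w) k
sumBelow-scaledGap-balanced r m w zero    = sym (ℤₚ.*-zeroʳ (+ suc r))
sumBelow-scaledGap-balanced r m w (suc k) =
  trans (cong (_+ scaledGap r (wsum m) m w k) (sumBelow-scaledGap-balanced r m w k))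
        (distribute (+ suc r) (sumBelow (gap r (wsum m) m w) k) (gap r (wsum m) m w k) (+ wsum m))
  where
  distribute : ∀ N S g W → N * S + (N * g + (W - W)) ≡ N * (S + g)
  distribute = solve-∀

sumBelow-gap-total : ∀ r m w → 1 ≤ r → sumBelow (gap r (wsum m) m w) (suc r) ≡ 0ℤ
sumBelow-gap-total r m w 1≤r = ℤₚ.*-cancelˡ-≡ (+ suc r) _ 0ℤ (begin
  + suc r * sumBelow (gap r (wsum m) m w) (suc r)  ≡⟨ sumBelow-scaledGap-balanced r m w (suc r) ⟨
  sumBelow (scaledGap r (wsum m) m w) (suc r)      ≡⟨ sumBelow-scaledGap-total r (wsum m) m w 1≤r ⟩
  0ℤ                                               ≡⟨ ℤₚ.*-zeroʳ (+ suc r) ⟨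
  + suc r * 0ℤ                                     ∎)
  where open ≡-Reasoning

Dominates : ∀ r → ℕ → (Fin r → ℕ) → List (Fin r) → Set
Dominates r ℓ m w = ∀ k → 1 ≤ k → k ≤ r → 0ℤ ≤ℤ sumBelow (gap r ℓ m w) k

InAlt⇔Dominates : ∀ r m w → 1 ≤ r → InAlt r (wsum m) m (act w) ⇔ Dominates r (wsum m) m w
InAlt⇔Dominates r m w 1≤r = mk⇔ to from
  where
  N = + suc r
  D = sumBelow (gap r (wsum m) m w)
  coordinate : ∀ k → shiftedDiff r (wsum m) m w k ≡ N * D (suc (toℕ k))
  coordinate k = trans (shiftedDiff≡sumBelow r (wsum m) m w 1≤r k) (sumBelow-scaledGap-balanced r m w (suc (toℕ k)))
  to : InAlt r (wsum m) m (act w) → Dominates r (wsum m) m w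
  to kp (suc k) _ k<r = ℤₚ.*-cancelˡ-≤-pos 0ℤ (D (suc k)) N (subst₂ _≤ℤ_ (sym (ℤₚ.*-zeroʳ N)) N*D≡ 0≤ξ)
    where
    k′ = fromℕ< k<r
    0≤ξ : 0ℤ ≤ℤ shiftedDiff r (wsum m) m w k′
    0≤ξ = KostantPos⇒nonneg r (shiftedDiff r (wsum m) m w) kp k′
    N*D≡ : shiftedDiff r (wsum m) m w k′ ≡ N * D (suc k)
    N*D≡ = trans (coordinate k′) (cong (λ i → N * D (suc i)) (Finₚ.toℕ-fromℕ< k<r))
  from : Dominates r (wsum m) m w → InAlt r (wsum m) m (act w)
  from dom = KostantPos-of-multiples r (shiftedDiff r (wsum m) m w) λ k →
    let 0≤D = dom (suc (toℕ k)) (s≤s z≤n) (Finₚ.toℕ<n k) in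
    ∣ D (suc (toℕ k)) ∣ , trans (coordinate k) (cong (N *_) (sym (ℤₚ.0≤i⇒+∣i∣≡i 0≤D)))

-- No divisibility hypothesis is needed: ξ_1 + ξ_r < 0 for every ℓ.
s₁∉alternation : ∀ r ℓ (m : Fin r → ℕ) → 1 ≤ r → ¬ InAlt r ℓ m (sN 1)
s₁∉alternation (suc r′) ℓ m 1≤r kp = ℕₚ.<-irrefl refl (ℕₚ.≤-trans r≤ bound)
  where
  r = suc r′
  w : List (Fin r)
  w = fzero ∷ []
  H = scaledGap r ℓ m w
  g = gap r ℓ m w
  A = lamRhoε r ℓ (wordPerm w r)
  nonneg : ∀ k → 0ℤ ≤ℤ sumBelow H (suc (toℕ k))
  nonneg k = subst (0ℤ ≤ℤ_) (shiftedDiff≡sumBelow r ℓ m w 1≤r k) (KostantPos⇒nonneg r _ kp k)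
  S≡ : sumBelow H r ≡ sumBelow H (suc (toℕ (fromℕ r′)))
  S≡ = cong (λ i → sumBelow H (suc i)) (sym (Finₚ.toℕ-fromℕ r′))
  first+last : H 0 + sumBelow H r ≡ + suc r * (g 0 - g r)
  first+last = begin
    H 0 + sumBelow H r                        ≡⟨ split (+ suc r) (g 0) (g r) (+ wsum m - + ℓ) (sumBelow H r) ⟩
    (H 0 - H r) + (sumBelow H r + H r)
      ≡⟨ cong (λ z → (H 0 - H r) + z) (sumBelow-scaledGap-total r ℓ m w 1≤r) ⟩
    (H 0 - H r) + 0ℤ                          ≡⟨ collapse (+ suc r) (g 0) (g r) (+ wsum m - + ℓ) ⟩
    + suc r * (g 0 - g r)                     ∎
    where
    open ≡-Reasoning
    split : ∀ N a b K S → (N * a + K) + S ≡ ((N * a + K) - (N * b + K)) + (S + (N * b + K))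
    split = solve-∀
    collapse : ∀ N a b K → ((N * a + K) - (N * b + K)) + 0ℤ ≡ N * (a - b)
    collapse = solve-∀
  0≤g0-gr : 0ℤ ≤ℤ g 0 - g r
  0≤g0-gr = ℤₚ.*-cancelˡ-≤-pos 0ℤ (g 0 - g r) (+ suc r)
    (subst₂ _≤ℤ_ (sym (ℤₚ.*-zeroʳ (+ suc r))) first+last
      (ℤₚ.+-mono-≤ (subst (0ℤ ≤ℤ_) (ℤₚ.+-identityˡ (H 0)) (nonneg fzero))
                   (subst (0ℤ ≤ℤ_) (sym S≡) (nonneg (fromℕ r′)))))
  muRhoε-last : muRhoε m r ≡ 0
  muRhoε-last = cong₂ _+ℕ_ (tailSum-beyond m r ℕₚ.≤-refl) (ℕₚ.n∸n≡0 r)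
  g0-gr≡ : g 0 - g r ≡ + r′ - + (tailSum m 0 +ℕ r +ℕ A)
  g0-gr≡ = begin
    (+ r′ - + (tailSum m 0 +ℕ r)) - (+ A - + muRhoε m r)
      ≡⟨ cong (λ z → (+ r′ - + (tailSum m 0 +ℕ r)) - (+ A - + z)) muRhoε-last ⟩
    (+ r′ - + (tailSum m 0 +ℕ r)) - (+ A - + 0)
      ≡⟨ regroup (+ r′) (+ (tailSum m 0 +ℕ r)) (+ A) ⟩
    + r′ - (+ (tailSum m 0 +ℕ r) + + A)
      ≡⟨ cong (+ r′ -_) (ℤₚ.pos-+ (tailSum m 0 +ℕ r) A) ⟨
    + r′ - + (tailSum m 0 +ℕ r +ℕ A) ∎
    where
    open ≡-Reasoning
    regroup : ∀ R C A → (R - C) - (A - + 0) ≡ R - (C + A)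
    regroup = solve-∀
  bound : tailSum m 0 +ℕ r +ℕ A ≤ r′
  bound = ℤₚ.drop‿+≤+ (ℤₚ.0≤i-j⇒j≤i (subst (0ℤ ≤ℤ_) g0-gr≡ 0≤g0-gr))
  r≤ : r ≤ tailSum m 0 +ℕ r +ℕ A
  r≤ = ℕₚ.≤-trans (ℕₚ.m≤n+m r (tailSum m 0)) (ℕₚ.m≤m+n _ A)

lamRhoε-muRhoε : ∀ r ℓ (m : Fin r → ℕ) p j → 1 ≤ p → p ≤ r → j ≤ r →
  + lamRhoε r ℓ p - + muRhoε m j ≡ + j - (+ p + + tailSum m j)
lamRhoε-muRhoε r ℓ m (suc p) j _ p≤r j≤r = begin
  + (r ∸ suc p) - + (tailSum m j +ℕ (r ∸ j))
    ≡⟨ cong₂ _-_ (+[m∸n]≡+m-+n p≤r)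
                 (trans (ℤₚ.pos-+ (tailSum m j) (r ∸ j)) (cong (λ z → + tailSum m j + z) (+[m∸n]≡+m-+n j≤r))) ⟩
  (+ r - + suc p) - (+ tailSum m j + (+ r - + j))
    ≡⟨ cancel (+ r) (+ suc p) (+ tailSum m j) (+ j) ⟩
  + j - (+ suc p + + tailSum m j) ∎
  where
  open ≡-Reasoning
  cancel : ∀ R P T J → (R - P) - (T + (R - J)) ≡ J - (P + T)
  cancel = solve-∀

gap≤0⇔ : ∀ r ℓ (m : Fin r → ℕ) w j → 1 ≤ wordPerm w j → wordPerm w j ≤ r → j ≤ r →
  gap r ℓ m w j ≤ℤ 0ℤ ⇔ j ≤ wordPerm w j +ℕ tailSum m j
gap≤0⇔ r ℓ m w j 1≤π π≤r j≤r = mk⇔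
  (λ g≤0 → ℤₚ.drop‿+≤+ (subst (+ j ≤ℤ_) (sym +π+t) (ℤₚ.i-j≤0⇒i≤j (subst (_≤ℤ 0ℤ) g≡ g≤0))))
  (λ j≤π+t → subst (_≤ℤ 0ℤ) (sym g≡) (ℤₚ.i≤j⇒i-j≤0 (subst (+ j ≤ℤ_) +π+t (+≤+ j≤π+t))))
  where
  π = wordPerm w j
  g≡ : gap r ℓ m w j ≡ + j - (+ π + + tailSum m j)
  g≡ = lamRhoε-muRhoε r ℓ m π j 1≤π π≤r j≤r
  +π+t : + (π +ℕ tailSum m j) ≡ + π + + tailSum m j
  +π+t = ℤₚ.pos-+ π (tailSum m j)

gap-fixed : ∀ r ℓ (m : Fin r → ℕ) w j → 1 ≤ j → j ≤ r → wordPerm w j ≡ j → tailSum m j ≡ 0 →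
  gap r ℓ m w j ≡ 0ℤ
gap-fixed r ℓ m w j 1≤j j≤r π≡j t≡0 = begin
  + lamRhoε r ℓ (wordPerm w j) - + muRhoε m j
    ≡⟨ cong (λ p → + lamRhoε r ℓ p - + muRhoε m j) π≡j ⟩
  + lamRhoε r ℓ j - + muRhoε m j
    ≡⟨ lamRhoε-muRhoε r ℓ m j j 1≤j j≤r j≤r ⟩
  + j - (+ j + + tailSum m j)
    ≡⟨ cong (λ t → + j - (+ j + + t)) t≡0 ⟩
  + j - (+ j + + 0)
    ≡⟨ cancel (+ j) ⟩
  0ℤ ∎
  where
  open ≡-Reasoning
  cancel : ∀ J → J - (J + + 0) ≡ 0ℤ
  cancel = solve-∀

dominates⇒wordPerm-zero : ∀ r m w → 1 ≤ r → Dominates r (wsum m) m w → wordPerm w 0 ≡ 0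
dominates⇒wordPerm-zero r m w 1≤r dom with wordPerm w 0 in π0≡ | dom 1 ℕₚ.≤-refl 1≤r
... | zero  | _    = refl
... | suc p | 0≤D1 =
  ⊥-elim (ℕₚ.<-irrefl refl (ℕₚ.<-≤-trans r∸p<r (ℕₚ.≤-trans (ℕₚ.m≤n+m r (tailSum m 0)) μ≤λ)))
  where
  1+p≤r : suc p ≤ r
  1+p≤r = subst (_≤ r) π0≡ (wordPerm-≤ w z≤n)
  r∸p<r : r ∸ suc p < r
  r∸p<r = ℕₚ.∸-monoʳ-< {r} {suc p} {0} (s≤s z≤n) 1+p≤r
  μ≤λ : tailSum m 0 +ℕ r ≤ r ∸ suc p
  μ≤λ = ℤₚ.drop‿+≤+ (ℤₚ.0≤i-j⇒j≤i (subst (0ℤ ≤ℤ_) (ℤₚ.+-identityˡ _) 0≤D1))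

-- Beyond k all gaps vanish, so the k-th partial sum is −gap k.
dominates⇒≤wordPerm+tailSum : ∀ r m w k → 1 ≤ k → k ≤ r → Dominates r (wsum m) m w → wordPerm w 0 ≡ 0 →
  (∀ j → k < j → j ≤ r → wordPerm w j ≡ j) → (∀ j → k < j → tailSum m j ≡ 0) →
  k ≤ wordPerm w k +ℕ tailSum m k
dominates⇒≤wordPerm+tailSum r m w k 1≤k k≤r dom π0≡0 fixed tail≡0 =
  Equivalence.to (gap≤0⇔ r (wsum m) m w k (wordPerm-pos w π0≡0 1≤k) (wordPerm-≤ w k≤r) k≤r) gap≤0
  where
  g = gap r (wsum m) m w
  D[1+k]≡0 : sumBelow g (suc k) ≡ 0ℤ
  D[1+k]≡0 = trans (sym (sumBelow-stable g (suc r) (s≤s k≤r) gaps-vanish))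
                   (sumBelow-gap-total r m w (ℕₚ.≤-trans 1≤k k≤r))
    where
    gaps-vanish : ∀ j → suc k ≤ j → j < suc r → g j ≡ 0ℤ
    gaps-vanish j k<j j<1+r = gap-fixed r (wsum m) m w j (ℕₚ.≤-trans (s≤s z≤n) k<j) (ℕₚ.≤-pred j<1+r)
                                      (fixed j k<j (ℕₚ.≤-pred j<1+r)) (tail≡0 j k<j)
  gap≤0 : g k ≤ℤ 0ℤ
  gap≤0 = subst (_≤ℤ 0ℤ) (sym (trans (rearrange (sumBelow g k) (g k)) (cong (_- sumBelow g k) D[1+k]≡0)))
                (ℤₚ.i≤j⇒i-j≤0 (dom k 1≤k k≤r))
    where
    rearrange : ∀ D x → x ≡ (D + x) - D
    rearrange = solve-∀

-- Downward induction: at each k ≥ N the previous lemma gives k ≤ σ(k) ≤ r, while σ fixes (k, r].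
dominates⇒fixed : ∀ r m w N → 1 ≤ N → Dominates r (wsum m) m w → wordPerm w 0 ≡ 0 →
  (∀ j → N ≤ j → tailSum m j ≡ 0) → ∀ j → N ≤ j → j ≤ r → wordPerm w j ≡ j
dominates⇒fixed r m w N 1≤N dom π0≡0 tail≡0 j N≤j j≤r =
  fixed-from (r ∸ j) j (ℕₚ.m∸n+n≡m j≤r) N≤j j ℕₚ.≤-refl j≤r
  where
  fixed-from : ∀ d k → d +ℕ k ≡ r → N ≤ k → ∀ j → k ≤ j → j ≤ r → wordPerm w j ≡ j
  fixed-beyond : ∀ d k → d +ℕ k ≡ r → N ≤ k → ∀ j → k < j → j ≤ r → wordPerm w j ≡ j
  fixed-from d k d+k≡r N≤k j k≤j j≤r with ℕₚ.m≤n⇒m<n∨m≡n k≤j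
  ... | inj₁ k<j  = fixed-beyond d k d+k≡r N≤k j k<j j≤r
  ... | inj₂ refl = injective-fixed (wordPerm w) (wordPerm-injective w) (fixed-beyond d k d+k≡r N≤k)
      (subst (k ≤_) (trans (cong (wordPerm w k +ℕ_) (tail≡0 k N≤k)) (ℕₚ.+-identityʳ _))
        (dominates⇒≤wordPerm+tailSum r m w k (ℕₚ.≤-trans 1≤N N≤k) j≤r dom π0≡0 (fixed-beyond d k d+k≡r N≤k)
                             (λ i k<i → tail≡0 i (ℕₚ.≤-trans N≤k (ℕₚ.<⇒≤ k<i)))))
      (wordPerm-≤ w j≤r)
  fixed-beyond zero    k refl    _   j k<j j≤k = ⊥-elim (ℕₚ.<⇒≱ k<j j≤k)
  fixed-beyond (suc d) k 1+d+k≡r N≤k j k<j j≤r =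
    fixed-from d (suc k) (trans (ℕₚ.+-suc d k) 1+d+k≡r) (ℕₚ.m≤n⇒m≤1+n N≤k) j k<j j≤r

-- All gaps but the first are ≤ 0 and the gaps sum to 0, so every partial sum is ≥ 0.
≤wordPerm+tailSum⇒dominates : ∀ r m w → 1 ≤ r → wordPerm w 0 ≡ 0 →
  (∀ j → 1 ≤ j → j ≤ r → j ≤ wordPerm w j +ℕ tailSum m j) → Dominates r (wsum m) m w
≤wordPerm+tailSum⇒dominates r m w 1≤r π0≡0 excess k 1≤k k≤r =
  subst (_≤ℤ sumBelow g k) (sumBelow-gap-total r m w 1≤r)
        (sumBelow-antitone g (suc r) (ℕₚ.m≤n⇒m≤1+n k≤r) gap≤0)
  where
  g = gap r (wsum m) m w
  gap≤0 : ∀ j → k ≤ j → j < suc r → g j ≤ℤ 0ℤ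
  gap≤0 j k≤j j<1+r =
    Equivalence.from (gap≤0⇔ r (wsum m) m w j (wordPerm-pos w π0≡0 1≤j) (wordPerm-≤ w j≤r) j≤r)
                     (excess j 1≤j j≤r)
    where
    1≤j = ℕₚ.≤-trans 1≤k k≤j
    j≤r = ℕₚ.≤-pred j<1+r

alternation-trivial : ∀ r (m : Fin r → ℕ) → 1 ≤ r → (∀ j → 2 < j → mAt m j ≡ 0) →
  ∀ w → InAlt r (wsum m) m (act w) ⇔ act w ≈W id
alternation-trivial r m 1≤r m≡0 w = mk⇔ to from
  where
  to : InAlt r (wsum m) m (act w) → act w ≈W id
  to inAlt = act-cong w [] agree
    where
    dom : Dominates r (wsum m) m w
    dom = Equivalence.to (InAlt⇔Dominates r m w 1≤r) inAlt
    π0≡0 : wordPerm w 0 ≡ 0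
    π0≡0 = dominates⇒wordPerm-zero r m w 1≤r dom
    fixed : ∀ j → 2 ≤ j → j ≤ r → wordPerm w j ≡ j
    fixed = dominates⇒fixed r m w 2 (s≤s z≤n) dom π0≡0 (tailSum-vanish m 2 m≡0)
    agree : ∀ j → j < r → wordPerm w j ≡ j
    agree zero          _   = π0≡0
    agree (suc zero)    1<r = ℕₚ.≤-antisym (ℕₚ.≤-pred (wordPerm-< w 2 fixed ℕₚ.≤-refl (ℕₚ.<⇒≤ 1<r)))
                                           (wordPerm-pos w π0≡0 ℕₚ.≤-refl)
    agree (suc (suc j)) j<r = fixed (suc (suc j)) (s≤s (s≤s z≤n)) (ℕₚ.<⇒≤ j<r)
  from : act w ≈W id → InAlt r (wsum m) m (act w)
  from w≈id = InAlt-cong r (wsum m) m (λ x k → sym (w≈id x k))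
    (Equivalence.from (InAlt⇔Dominates r m [] 1≤r)
      (≤wordPerm+tailSum⇒dominates r m [] 1≤r refl (λ j _ _ → ℕₚ.m≤m+n j (tailSum m j))))

data S₃ : Set where
  e s₂ s₃ s₂s₃ s₃s₂ s₂s₃s₂ : S₃

-- The subgroup ⟨s₂, s₃⟩ permuting ε_2, ε_3, ε_4; the letter fsuc fzero stands for s₂ since act
-- applies sN (suc (toℕ t)).
word : ∀ {r′} → S₃ → List (Fin (suc (suc (suc r′))))
word e      = []
word s₂     = fsuc fzero ∷ []
word s₃     = fsuc (fsuc fzero) ∷ []
word s₂s₃   = fsuc fzero ∷ fsuc (fsuc fzero) ∷ []
word s₃s₂   = fsuc (fsuc fzero) ∷ fsuc fzero ∷ []
word s₂s₃s₂ = fsuc fzero ∷ fsuc (fsuc fzero) ∷ fsuc fzero ∷ []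

word-zero : ∀ {r′} σ → wordPerm (word {r′} σ) 0 ≡ 0
word-zero e      = refl
word-zero s₂     = refl
word-zero s₃     = refl
word-zero s₂s₃   = refl
word-zero s₃s₂   = refl
word-zero s₂s₃s₂ = refl

word-fixes : ∀ {r′} σ j → 3 < j → wordPerm (word {r′} σ) j ≡ j
word-fixes e      _ (s≤s (s≤s (s≤s (s≤s _)))) = refl
word-fixes s₂     _ (s≤s (s≤s (s≤s (s≤s _)))) = refl
word-fixes s₃     _ (s≤s (s≤s (s≤s (s≤s _)))) = refl
word-fixes s₂s₃   _ (s≤s (s≤s (s≤s (s≤s _)))) = refl
word-fixes s₃s₂   _ (s≤s (s≤s (s≤s (s≤s _)))) = refl
word-fixes s₂s₃s₂ _ (s≤s (s≤s (s≤s (s≤s _)))) = refl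

data OneToThree : ℕ → Set where
  one   : OneToThree 1
  two   : OneToThree 2
  three : OneToThree 3

oneToThree : ∀ {a} → 1 ≤ a → a < 4 → OneToThree a
oneToThree {1} _ _ = one
oneToThree {2} _ _ = two
oneToThree {3} _ _ = three
oneToThree {suc (suc (suc (suc a)))} _ (s≤s (s≤s (s≤s (s≤s ()))))

S₃-complete : ∀ {r′ a b c} → OneToThree a → OneToThree b → OneToThree c → a ≢ b → a ≢ c → b ≢ c →
  Σ S₃ λ σ → wordPerm (word {r′} σ) 1 ≡ a × wordPerm (word {r′} σ) 2 ≡ b × wordPerm (word {r′} σ) 3 ≡ c
S₃-complete one   two   three _ _ _ = e      , refl , refl , refl
S₃-complete two   one   three _ _ _ = s₂     , refl , refl , refl
S₃-complete one   three two   _ _ _ = s₃     , refl , refl , refl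
S₃-complete three one   two   _ _ _ = s₂s₃   , refl , refl , refl
S₃-complete two   three one   _ _ _ = s₃s₂   , refl , refl , refl
S₃-complete three two   one   _ _ _ = s₂s₃s₂ , refl , refl , refl
S₃-complete one   one   _     a≢b _   _   = ⊥-elim (a≢b refl)
S₃-complete two   two   _     a≢b _   _   = ⊥-elim (a≢b refl)
S₃-complete three three _     a≢b _   _   = ⊥-elim (a≢b refl)
S₃-complete one   _     one   _   a≢c _   = ⊥-elim (a≢c refl)
S₃-complete two   _     two   _   a≢c _   = ⊥-elim (a≢c refl)
S₃-complete three _     three _   a≢c _   = ⊥-elim (a≢c refl)
S₃-complete _     one   one   _   _   b≢c = ⊥-elim (b≢c refl)
S₃-complete _     two   two   _   _   b≢c = ⊥-elim (b≢c refl)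
S₃-complete _     three three _   _   b≢c = ⊥-elim (b≢c refl)

wordPerm-S₃ : ∀ {r′} (w : List (Fin (suc (suc (suc r′))))) → wordPerm w 0 ≡ 0 →
  (∀ j → 4 ≤ j → j ≤ suc (suc (suc r′)) → wordPerm w j ≡ j) →
  Σ S₃ λ σ → ∀ j → j ≤ suc (suc (suc r′)) → wordPerm w j ≡ wordPerm (word {r′} σ) j
wordPerm-S₃ {r′} w π0≡0 fixed =
  extend (S₃-complete (inRange 1 ℕₚ.≤-refl (s≤s (s≤s z≤n))) (inRange 2 (s≤s z≤n) (s≤s (s≤s (s≤s z≤n))))
                      (inRange 3 (s≤s z≤n) ℕₚ.≤-refl) (distinct (λ ())) (distinct (λ ())) (distinct (λ ())))
  where
  inRange : ∀ j → 1 ≤ j → j < 4 → OneToThree (wordPerm w j)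
  inRange j 1≤j j<4 = oneToThree (wordPerm-pos w π0≡0 1≤j)
    (wordPerm-< w 4 fixed j<4 (ℕₚ.≤-trans (ℕₚ.≤-pred j<4) (s≤s (s≤s (s≤s z≤n)))))
  distinct : ∀ {i j} → i ≢ j → wordPerm w i ≢ wordPerm w j
  distinct i≢j = i≢j ∘ wordPerm-injective w
  extend : (Σ S₃ λ σ → wordPerm (word {r′} σ) 1 ≡ wordPerm w 1 × wordPerm (word {r′} σ) 2 ≡ wordPerm w 2
                      × wordPerm (word {r′} σ) 3 ≡ wordPerm w 3) →
    Σ S₃ λ σ → ∀ j → j ≤ suc (suc (suc r′)) → wordPerm w j ≡ wordPerm (word {r′} σ) j
  extend (σ , π₁ , π₂ , π₃) = σ , agree
    where
    agree : ∀ j → j ≤ suc (suc (suc r′)) → wordPerm w j ≡ wordPerm (word {r′} σ) j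
    agree 0 _ = trans π0≡0 (sym (word-zero σ))
    agree 1 _ = sym π₁
    agree 2 _ = sym π₂
    agree 3 _ = sym π₃
    agree j@(suc (suc (suc (suc _)))) j≤r = trans (fixed j 4≤j j≤r) (sym (word-fixes σ j 4≤j))
      where
      4≤j : 4 ≤ j
      4≤j = s≤s (s≤s (s≤s (s≤s z≤n)))

-- wordPerm indices are 0-based: wordPerm (word σ) 3 = p means that σ sends ε_4 to ε_{p+1}.
AdmissibleWord : ∀ {r′} → (Fin (suc (suc (suc r′))) → ℕ) → List (Fin (suc (suc (suc r′)))) → Set
AdmissibleWord {r′} m w = Σ S₃ λ σ → 3 ≤ wordPerm (word {r′} σ) 3 +ℕ mAt m 4 × act w ≈W act (word σ)

S₃-alternation : ∀ r′ (m : Fin (suc (suc (suc r′))) → ℕ) → (∀ j → 4 < j → mAt m j ≡ 0) →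
  1 ≤ mAt m 3 +ℕ mAt m 4 → ∀ w → InAlt (suc (suc (suc r′))) (wsum m) m (act w) ⇔ AdmissibleWord m w
S₃-alternation r′ m m≡0 1≤m₃+m₄ w = mk⇔ to from
  where
  r = suc (suc (suc r′))
  1≤r : 1 ≤ r
  1≤r = s≤s z≤n
  3≤r : 3 ≤ r
  3≤r = s≤s (s≤s (s≤s z≤n))
  tail≡0 : ∀ j → 4 ≤ j → tailSum m j ≡ 0
  tail≡0 = tailSum-vanish m 4 m≡0
  tail₃ : tailSum m 3 ≡ mAt m 4
  tail₃ = trans (tailSum-suc m 3) (trans (cong (mAt m 4 +ℕ_) (tail≡0 4 ℕₚ.≤-refl)) (ℕₚ.+-identityʳ _))
  tail₂ : tailSum m 2 ≡ mAt m 3 +ℕ mAt m 4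
  tail₂ = trans (tailSum-suc m 2) (cong (mAt m 3 +ℕ_) tail₃)

  to : InAlt r (wsum m) m (act w) → AdmissibleWord m w
  to inAlt = σ , condition , act-cong w (word σ) (λ j j<r → agree j (ℕₚ.<⇒≤ j<r))
    where
    dom : Dominates r (wsum m) m w
    dom = Equivalence.to (InAlt⇔Dominates r m w 1≤r) inAlt
    π0≡0 : wordPerm w 0 ≡ 0
    π0≡0 = dominates⇒wordPerm-zero r m w 1≤r dom
    fixed : ∀ j → 4 ≤ j → j ≤ r → wordPerm w j ≡ j
    fixed = dominates⇒fixed r m w 4 (s≤s z≤n) dom π0≡0 tail≡0
    classified : Σ S₃ λ σ → ∀ j → j ≤ r → wordPerm w j ≡ wordPerm (word {r′} σ) j
    classified = wordPerm-S₃ w π0≡0 fixed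
    σ = proj₁ classified
    agree = proj₂ classified
    condition : 3 ≤ wordPerm (word {r′} σ) 3 +ℕ mAt m 4
    condition = subst₂ (λ p t → 3 ≤ p +ℕ t) (agree 3 3≤r) tail₃
      (dominates⇒≤wordPerm+tailSum r m w 3 (s≤s z≤n) 3≤r dom π0≡0
                                   (λ j 3<j → fixed j 3<j) (λ j 3<j → tail≡0 j 3<j))

  from : AdmissibleWord m w → InAlt r (wsum m) m (act w)
  from (σ , condition , w≈σ) = InAlt-cong r (wsum m) m (λ x k → sym (w≈σ x k))
    (Equivalence.from (InAlt⇔Dominates r m (word σ) 1≤r)
                      (≤wordPerm+tailSum⇒dominates r m (word σ) 1≤r (word-zero σ) excess))
    where
    π = wordPerm (word {r′} σ)
    1≤π : ∀ {j} → 1 ≤ j → 1 ≤ π j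
    1≤π = wordPerm-pos (word σ) (word-zero σ)
    excess : ∀ j → 1 ≤ j → j ≤ r → j ≤ π j +ℕ tailSum m j
    excess 1 _ _ = ℕₚ.≤-trans (1≤π ℕₚ.≤-refl) (ℕₚ.m≤m+n (π 1) (tailSum m 1))
    excess 2 _ _ = ℕₚ.+-mono-≤ (1≤π (s≤s z≤n)) (subst (1 ≤_) (sym tail₂) 1≤m₃+m₄)
    excess 3 _ _ = subst (λ t → 3 ≤ π 3 +ℕ t) (sym tail₃) condition
    excess j@(suc (suc (suc (suc _)))) _ _ =
      subst (λ p → j ≤ p +ℕ tailSum m j) (sym (word-fixes σ j (s≤s (s≤s (s≤s (s≤s z≤n))))))
            (ℕₚ.m≤m+n j (tailSum m j))

alternation-m₃ : ∀ r (m : Fin r → ℕ) → (∀ j → 3 < j → mAt m j ≡ 0) → mAt m 3 ≢ 0 →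
  ∀ w → InAlt r (wsum m) m (act w) ⇔ (act w ≈W id ⊎ act w ≈W sN 2)
alternation-m₃ 0 m _ m₃≢0 = ⊥-elim (m₃≢0 refl)
alternation-m₃ 1 m _ m₃≢0 = ⊥-elim (m₃≢0 refl)
alternation-m₃ 2 m _ m₃≢0 = ⊥-elim (m₃≢0 refl)
alternation-m₃ (suc (suc (suc r′))) m m≡0 m₃≢0 w = mk⇔ (cases ∘ Equivalence.to criterion) from
  where
  m₄≡0 : mAt m 4 ≡ 0
  m₄≡0 = m≡0 4 ℕₚ.≤-refl
  criterion : InAlt _ (wsum m) m (act w) ⇔ AdmissibleWord m w
  criterion = S₃-alternation r′ m (λ j 4<j → m≡0 j (ℕₚ.<⇒≤ 4<j))
                             (ℕₚ.≤-trans (ℕₚ.n≢0⇒n>0 m₃≢0) (ℕₚ.m≤m+n (mAt m 3) (mAt m 4))) w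
  unreachable : ∀ {p} → p < 3 → ¬ 3 ≤ p +ℕ mAt m 4
  unreachable {p} p<3 3≤p+m₄ =
    ℕₚ.<⇒≱ p<3 (subst (3 ≤_) (trans (cong (p +ℕ_) m₄≡0) (ℕₚ.+-identityʳ p)) 3≤p+m₄)
  cases : AdmissibleWord m w → act w ≈W id ⊎ act w ≈W sN 2
  cases (e      , _       , w≈σ) = inj₁ w≈σ
  cases (s₂     , _       , w≈σ) = inj₂ w≈σ
  cases (s₃     , 3≤σ₃+m₄ , _)   = ⊥-elim (unreachable ℕₚ.≤-refl 3≤σ₃+m₄)
  cases (s₂s₃   , 3≤σ₃+m₄ , _)   = ⊥-elim (unreachable ℕₚ.≤-refl 3≤σ₃+m₄)
  cases (s₃s₂   , 3≤σ₃+m₄ , _)   = ⊥-elim (unreachable (ℕₚ.n≤1+n 2) 3≤σ₃+m₄)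
  cases (s₂s₃s₂ , 3≤σ₃+m₄ , _)   = ⊥-elim (unreachable (ℕₚ.n≤1+n 2) 3≤σ₃+m₄)
  from : act w ≈W id ⊎ act w ≈W sN 2 → InAlt _ (wsum m) m (act w)
  from (inj₁ w≈id) = Equivalence.from criterion (e  , ℕₚ.m≤m+n 3 (mAt m 4) , w≈id)
  from (inj₂ w≈s₂) = Equivalence.from criterion (s₂ , ℕₚ.m≤m+n 3 (mAt m 4) , w≈s₂)

alternation-m₄≡1 : ∀ r (m : Fin r → ℕ) → (∀ j → 4 < j → mAt m j ≡ 0) → mAt m 4 ≡ 1 →
  ∀ w → InAlt r (wsum m) m (act w) ⇔
    (act w ≈W id ⊎ act w ≈W sN 2 ⊎ act w ≈W sN 3 ⊎ act w ≈W (sN 2 ∘ sN 3))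
alternation-m₄≡1 0 m _ ()
alternation-m₄≡1 1 m _ ()
alternation-m₄≡1 2 m _ ()
alternation-m₄≡1 3 m _ ()
alternation-m₄≡1 (suc (suc (suc (suc r″)))) m m≡0 m₄≡1 w = mk⇔ (cases ∘ Equivalence.to criterion) from
  where
  1≤m₄ : 1 ≤ mAt m 4
  1≤m₄ = ℕₚ.≤-reflexive (sym m₄≡1)
  criterion : InAlt _ (wsum m) m (act w) ⇔ AdmissibleWord m w
  criterion = S₃-alternation (suc r″) m m≡0 (ℕₚ.≤-trans 1≤m₄ (ℕₚ.m≤n+m (mAt m 4) (mAt m 3))) w
  reached : ∀ {p} → 2 ≤ p → 3 ≤ p +ℕ mAt m 4
  reached 2≤p = ℕₚ.+-mono-≤ 2≤p 1≤m₄
  unreachable : ¬ 3 ≤ 1 +ℕ mAt m 4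
  unreachable 3≤1+m₄ = ℕₚ.<-irrefl refl (subst (λ k → 3 ≤ 1 +ℕ k) m₄≡1 3≤1+m₄)
  cases : AdmissibleWord m w →
    act w ≈W id ⊎ act w ≈W sN 2 ⊎ act w ≈W sN 3 ⊎ act w ≈W (sN 2 ∘ sN 3)
  cases (e      , _       , w≈σ) = inj₁ w≈σ
  cases (s₂     , _       , w≈σ) = inj₂ (inj₁ w≈σ)
  cases (s₃     , _       , w≈σ) = inj₂ (inj₂ (inj₁ w≈σ))
  cases (s₂s₃   , _       , w≈σ) = inj₂ (inj₂ (inj₂ w≈σ))
  cases (s₃s₂   , 3≤σ₃+m₄ , _)   = ⊥-elim (unreachable 3≤σ₃+m₄)
  cases (s₂s₃s₂ , 3≤σ₃+m₄ , _)   = ⊥-elim (unreachable 3≤σ₃+m₄)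
  from : act w ≈W id ⊎ act w ≈W sN 2 ⊎ act w ≈W sN 3 ⊎ act w ≈W (sN 2 ∘ sN 3) →
    InAlt _ (wsum m) m (act w)
  from (inj₁ w≈σ)               = Equivalence.from criterion (e    , reached (ℕₚ.n≤1+n 2) , w≈σ)
  from (inj₂ (inj₁ w≈σ))        = Equivalence.from criterion (s₂   , reached (ℕₚ.n≤1+n 2) , w≈σ)
  from (inj₂ (inj₂ (inj₁ w≈σ))) = Equivalence.from criterion (s₃   , reached ℕₚ.≤-refl    , w≈σ)
  from (inj₂ (inj₂ (inj₂ w≈σ))) = Equivalence.from criterion (s₂s₃ , reached ℕₚ.≤-refl    , w≈σ)

alternation-m₄≥2 : ∀ r (m : Fin r → ℕ) → (∀ j → 4 < j → mAt m j ≡ 0) → mAt m 4 ≥ 2 →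
  ∀ w → InAlt r (wsum m) m (act w) ⇔
    (act w ≈W id ⊎ act w ≈W sN 2 ⊎ act w ≈W sN 3 ⊎ act w ≈W (sN 2 ∘ sN 3)
      ⊎ act w ≈W (sN 3 ∘ sN 2) ⊎ act w ≈W (sN 2 ∘ sN 3 ∘ sN 2))
alternation-m₄≥2 0 m _ ()
alternation-m₄≥2 1 m _ ()
alternation-m₄≥2 2 m _ ()
alternation-m₄≥2 3 m _ ()
alternation-m₄≥2 (suc (suc (suc (suc r″)))) m m≡0 2≤m₄ w = mk⇔ (cases ∘ Equivalence.to criterion) from
  where
  criterion : InAlt _ (wsum m) m (act w) ⇔ AdmissibleWord m w
  criterion = S₃-alternation (suc r″) m m≡0 (ℕₚ.≤-trans (ℕₚ.<⇒≤ 2≤m₄) (ℕₚ.m≤n+m (mAt m 4) (mAt m 3))) w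
  reached : ∀ σ → 3 ≤ wordPerm (word {suc r″} σ) 3 +ℕ mAt m 4
  reached σ = ℕₚ.+-mono-≤ (wordPerm-pos (word σ) (word-zero σ) (s≤s z≤n)) 2≤m₄
  cases : AdmissibleWord m w →
    act w ≈W id ⊎ act w ≈W sN 2 ⊎ act w ≈W sN 3 ⊎ act w ≈W (sN 2 ∘ sN 3)
      ⊎ act w ≈W (sN 3 ∘ sN 2) ⊎ act w ≈W (sN 2 ∘ sN 3 ∘ sN 2)
  cases (e      , _ , w≈σ) = inj₁ w≈σ
  cases (s₂     , _ , w≈σ) = inj₂ (inj₁ w≈σ)
  cases (s₃     , _ , w≈σ) = inj₂ (inj₂ (inj₁ w≈σ))
  cases (s₂s₃   , _ , w≈σ) = inj₂ (inj₂ (inj₂ (inj₁ w≈σ)))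
  cases (s₃s₂   , _ , w≈σ) = inj₂ (inj₂ (inj₂ (inj₂ (inj₁ w≈σ))))
  cases (s₂s₃s₂ , _ , w≈σ) = inj₂ (inj₂ (inj₂ (inj₂ (inj₂ w≈σ))))
  from : act w ≈W id ⊎ act w ≈W sN 2 ⊎ act w ≈W sN 3 ⊎ act w ≈W (sN 2 ∘ sN 3)
           ⊎ act w ≈W (sN 3 ∘ sN 2) ⊎ act w ≈W (sN 2 ∘ sN 3 ∘ sN 2) → InAlt _ (wsum m) m (act w)
  from (inj₁ w≈σ)                             = Equivalence.from criterion (e      , reached e      , w≈σ)
  from (inj₂ (inj₁ w≈σ))                      = Equivalence.from criterion (s₂     , reached s₂     , w≈σ)
  from (inj₂ (inj₂ (inj₁ w≈σ)))               = Equivalence.from criterion (s₃     , reached s₃     , w≈σ)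
  from (inj₂ (inj₂ (inj₂ (inj₁ w≈σ))))        = Equivalence.from criterion (s₂s₃   , reached s₂s₃   , w≈σ)
  from (inj₂ (inj₂ (inj₂ (inj₂ (inj₁ w≈σ))))) = Equivalence.from criterion (s₃s₂   , reached s₃s₂   , w≈σ)
  from (inj₂ (inj₂ (inj₂ (inj₂ (inj₂ w≈σ))))) = Equivalence.from criterion (s₂s₃s₂ , reached s₂s₃s₂ , w≈σ)

theorem1p1 : (r : ℕ) → 1 ≤ r → (ℓ : ℕ) → (m : Fin r → ℕ) →
    ((+ (suc r)) ∣ (+ ℓ - + wsum m) → ¬ InAlt r ℓ m (sN 1))
    × (ℓ ≡ wsum m → (∀ j → 3 ≤ j → mAt m j ≡ 0) →
        ∀ (w : List (Fin r)) → InAlt r ℓ m (act w) ⇔ (act w ≈W id))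
    × (ℓ ≡ wsum m → (∀ j → 4 ≤ j → mAt m j ≡ 0) → mAt m 3 ≢ 0 →
        ∀ (w : List (Fin r)) → InAlt r ℓ m (act w) ⇔ (act w ≈W id ⊎ act w ≈W sN 2))
    × (ℓ ≡ wsum m → (∀ j → 5 ≤ j → mAt m j ≡ 0) → mAt m 4 ≢ 0 →
        (mAt m 4 ≡ 1 →
          ∀ (w : List (Fin r)) → InAlt r ℓ m (act w) ⇔
            (act w ≈W id ⊎ act w ≈W sN 2 ⊎ act w ≈W sN 3 ⊎ act w ≈W (sN 2 ∘ sN 3)))
        × (mAt m 4 ≥ 2 →
          ∀ (w : List (Fin r)) → InAlt r ℓ m (act w) ⇔
            (act w ≈W id ⊎ act w ≈W sN 2 ⊎ act w ≈W sN 3 ⊎ act w ≈W (sN 2 ∘ sN 3)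
              ⊎ act w ≈W (sN 3 ∘ sN 2) ⊎ act w ≈W (sN 2 ∘ sN 3 ∘ sN 2))))
theorem1p1 r 1≤r ℓ m =
    (λ _ → s₁∉alternation r ℓ m 1≤r)
  , (λ { refl → alternation-trivial r m 1≤r })
  , (λ { refl → alternation-m₃ r m })
  , (λ { refl m≡0 _ → alternation-m₄≡1 r m m≡0 , alternation-m₄≥2 r m m≡0 })
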